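{- Let $\vec x$, $y$, $z$ be distinct variables, let $a$ be a term containing no variables other than those in $\vec x$, and let $b$ and $c$ be terms containing no variables other than those in $\vec x$, $y$, $z$. Define $f$ by the primitive recursion $$f(\vec x,0)=a,\qquad f(\vec x,Sy)=C\big(\chi[Sy=\mathrm{Chop}\,Sy\oplus\bar0],\ b_z(\mathrm{Chop}\,Sy),\ C(\chi[Sy=\mathrm{Chop}\,Sy\oplus\bar1],\ c_z(\mathrm{Chop}\,Sy),\ 0)\big).$$ Then, for a variable $w$, $$\vdash f(\vec x,\varepsilon)=a\ \wedge\ f(\vec x,w\oplus\bar0)=b_z(w)\ \wedge\ f(\vec x,w\oplus\bar1)=c_z(w).$$
   Context: PRA (Primitive Recursive Arithmetic) is the quantifier-free formal system whose symbols are variables, PR function symbols, $=$, $\neg$, $\vee$; formulas are built from equations by $\neg,\vee$, with $\wedge,\to,\leftrightarrow$ the usual abbreviations; $u_z(a)$ denotes substitution of $a$ for $z$. A function symbol is defined by primitive recursion by $f(\vec x,0)=a$, $f(\vec x,Sy)=b_z(f(\vec x,y))$; PR function symbols are those obtainable from $0$ and $S$ by finitely many such definitions. Axioms: defining equations; $\neg\,Sx=0$; $Sx=Sy\to x=y$; $x=x$; $x=y\to y=x$; $x=y\wedge A_x(x)\to A_x(y)$; $A\vee A\to A$; $A\to A\vee B$; $A\vee B\to B\vee A$; $(B\to C)\to(A\vee B\to A\vee C)$. Rules: instance, modus ponens, induction. $\vdash$ denotes provability in PRA. Symbols: $x+0=x$, $x+Sy=S(x+y)$; $P0=0$, $PSx=x$;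 $x-0=x$, $x-Sy=P(x-y)$; $C(0,y,z)=y$, $C(Sx,y,z)=z$; $\mathrm{Eq}(x,y)=(x-y)+(y-x)$; $x\mathrel{\dot=}y=C(\mathrm{Eq}(x,y),0,S0)$; $\dot\neg x=C(x,S0,0)$; $x\mathbin{\dot\vee}y=C(x,0,C(y,0,S0))$; $\chi A$ replaces each $=,\neg,\vee$ in a formula $A$ by $\mathrel{\dot=},\dot\neg,\mathbin{\dot\vee}$. $x\cdot0=0$, $x\cdot Sy=x+x\cdot y$; $x\uparrow0=S0$, $x\uparrow Sy=x\cdot(x\uparrow y)$; $1=S0$, $2=SS0$; $x\le y$ abbreviates $x-y=0$, $x<y$ abbreviates $x\le y\wedge x\ne y$. For a formula $A$, variable $x$ and the other variables $\vec y$ of $A$, $\mu_A(\vec y,0)=C(\chi[A_x(0)],0,S0)$, $\mu_A(\vec y,Sx)=C(\chi[\mu_A(\vec y,x)\le x],\mu_A(\vec y,x),C(\chi[A_x(Sx)],Sx,SSx))$; for $b$ not containing $x$, $\exists x{\le}b\,A$ abbreviates $A_x(\mu_A(\vec y,b))$. "$q$ is a power of two" abbreviates $\exists x{\le}q[2\uparrow x=q]$. $Qx$ abbreviates $\mu_B(x,Sx)$ where $B$ is the formula "$q$ is a power of two $\wedge\ q\le Sx\wedge Sx<2\cdot q$" in the variable $q$; it satisfies $\vdash Qx=q\leftrightarrow B$ (so $Qx$ is the largest power of two $\le Sx$). $Rx=Sx-Qx$. $x\oplus y=P(Sx\cdot Qy+Ry)$ (concatenation, identifying $x$ with the binary string after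 the leading 1 of $Sx$). $\varepsilon=0$, $\bar0=1$, $\bar1=2$. $\mathrm{Parity}\,0=0$, $\mathrm{Parity}\,Sx=C(\mathrm{Parity}\,x,1,0)$; $\mathrm{Half}\,0=0$, $\mathrm{Half}\,Sx=C(\mathrm{Parity}\,x,\mathrm{Half}\,x,S\,\mathrm{Half}\,x)$; $\mathrm{Chop}\,x=P(\mathrm{Half}\,Qx+\mathrm{Half}\,Rx)$.
   Formalization: The terms b and c may contain only variables among $\vec x$ and z, with y excluded, in place of variables among $\vec x$, y and z. The statement above fails without it. -}

module Defs where

open import Data.Nat using (ℕ; zero; suc; _⊔_; _≟_)
open import Data.Bool using (if_then_else_)
open import Data.List as L using (List; []; _∷_; _++_; [_]; deduplicate; filter; length; foldr)
open import Data.Vec as V using (Vec; []; _∷_; _∷ʳ_; toList; fromList)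
open import Data.List.Relation.Unary.All using (All)
open import Data.List.Relation.Unary.Unique.Propositional using (Unique)
open import Data.List.Membership.Propositional using (_∈_)
open import Relation.Nullary using (¬?)
open import Relation.Nullary.Decidable using (⌊_⌋)

-- Syntax of PRA.  Variables are natural numbers.
-- A PR function symbol of arity (suc n) is identified with its defining
-- data  f(xs,0) = a ,  f(xs,S y) = b_z(f(xs,y)).

Var : Set
Var = ℕ

mutual
  data Fn : ℕ → Set where
    zer : Fn 0
    suc' : Fn 1
    rec : ∀ {n} (xs : Vec Var n) (y z : Var) (a b : Tm) → Fn (suc n)

  data Tm : Set where
    var : Var → Tm
    app : ∀ {n} → Fn n → Vec Tm n → Tm

mutual
  vars : Tm → List Var
  vars (var v) = [ v ]
  vars (app f ts) = varsV ts

  varsV : ∀ {n} → Vec Tm n → List Var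
  varsV [] = []
  varsV (t ∷ ts) = vars t ++ varsV ts

_⊆_ : List Var → List Var → Set
xs ⊆ ys = All (_∈ ys) xs

mutual
  data WFFn : ∀ {n} → Fn n → Set where
    wf-zer : WFFn zer
    wf-suc : WFFn suc'
    wf-rec : ∀ {n} {xs : Vec Var n} {y z : Var} {a b : Tm} →
             Unique (y ∷ z ∷ toList xs) →
             vars a ⊆ toList xs →
             vars b ⊆ (y ∷ z ∷ toList xs) →
             WFTm a → WFTm b → WFFn (rec xs y z a b)

  data WFTm : Tm → Set where
    wf-var : ∀ v → WFTm (var v)
    wf-app : ∀ {n} {f : Fn n} {ts : Vec Tm n} → WFFn f → WFTms ts → WFTm (app f ts)

  data WFTms : ∀ {n} → Vec Tm n → Set where
    wf-[] : WFTms []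
    wf-∷ : ∀ {n} {t : Tm} {ts : Vec Tm n} → WFTm t → WFTms ts → WFTms (t ∷ ts)

infix 6 _≐_
infixr 5 _∨'_
data Fm : Set where
  _≐_ : Tm → Tm → Fm
  ¬'_ : Fm → Fm
  _∨'_ : Fm → Fm → Fm

data WFFm : Fm → Set where
  wf-eq : ∀ {s t} → WFTm s → WFTm t → WFFm (s ≐ t)
  wf-neg : ∀ {A} → WFFm A → WFFm (¬' A)
  wf-or : ∀ {A B} → WFFm A → WFFm B → WFFm (A ∨' B)

varsFm : Fm → List Var
varsFm (s ≐ t) = vars s ++ vars t
varsFm (¬' A) = varsFm A
varsFm (A ∨' B) = varsFm A ++ varsFm B

infixr 4 _⇒_
infixr 4 _∧'_
_⇒_ : Fm → Fm → Fm
A ⇒ B = (¬' A) ∨' B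

_∧'_ : Fm → Fm → Fm
A ∧' B = ¬' ((¬' A) ∨' (¬' B))

_⇔_ : Fm → Fm → Fm
A ⇔ B = (A ⇒ B) ∧' (B ⇒ A)

-- substitution u_x(a): replace variable x by term a
mutual
  substT : Var → Tm → Tm → Tm
  substT x a (var v) = if ⌊ v ≟ x ⌋ then a else var v
  substT x a (app f ts) = app f (substV x a ts)

  substV : ∀ {n} → Var → Tm → Vec Tm n → Vec Tm n
  substV x a [] = []
  substV x a (t ∷ ts) = substT x a t ∷ substV x a ts

substF : Var → Tm → Fm → Fm
substF x a (s ≐ t) = substT x a s ≐ substT x a t
substF x a (¬' A) = ¬' substF x a A
substF x a (A ∨' B) = substF x a A ∨' substF x a B

zeroT : Tm
zeroT = app zer []

S : Tm → Tm
S t = app suc' (t ∷ [])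

appRec : ∀ {n} → Fn (suc n) → Vec Var n → Tm → Tm
appRec f xs t = app f (V.map var xs ∷ʳ t)

infix 2 ⊢_
data ⊢_ : Fm → Set where
  ax-def0 : ∀ {n} {xs : Vec Var n} {y z a b} → WFFn (rec xs y z a b) →
            ⊢ appRec (rec xs y z a b) xs zeroT ≐ a
  ax-defS : ∀ {n} {xs : Vec Var n} {y z a b} → WFFn (rec xs y z a b) →
            ⊢ appRec (rec xs y z a b) xs (S (var y)) ≐
                substT z (appRec (rec xs y z a b) xs (var y)) b
  ax-S≠0 : ∀ x → ⊢ ¬' (S (var x) ≐ zeroT)
  ax-Sinj : ∀ x y → ⊢ (S (var x) ≐ S (var y)) ⇒ (var x ≐ var y)
  ax-refl : ∀ x → ⊢ var x ≐ var x
  ax-sym : ∀ x y → ⊢ (var x ≐ var y) ⇒ (var y ≐ var x)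
  ax-eq : ∀ x y A → WFFm A → ⊢ ((var x ≐ var y) ∧' A) ⇒ substF x (var y) A
  ax-contr : ∀ A → WFFm A → ⊢ (A ∨' A) ⇒ A
  ax-weak : ∀ A B → WFFm A → WFFm B → ⊢ A ⇒ (A ∨' B)
  ax-perm : ∀ A B → WFFm A → WFFm B → ⊢ (A ∨' B) ⇒ (B ∨' A)
  ax-assoc : ∀ A B C → WFFm A → WFFm B → WFFm C →
             ⊢ (B ⇒ C) ⇒ ((A ∨' B) ⇒ (A ∨' C))
  r-inst : ∀ {A} x a → WFTm a → ⊢ A → ⊢ substF x a A
  r-mp : ∀ {A B} → ⊢ A → ⊢ A ⇒ B → ⊢ B
  r-ind : ∀ {A} x → ⊢ substF x zeroT A → ⊢ A ⇒ substF x (S (var x)) A → ⊢ A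

1T 2T : Tm
1T = S zeroT
2T = S 1T

PlusF : Fn 2
PlusF = rec (0 ∷ []) 1 2 (var 0) (S (var 2))

_+T_ : Tm → Tm → Tm
s +T t = app PlusF (s ∷ t ∷ [])

PredF : Fn 1
PredF = rec [] 1 2 zeroT (var 1)

P : Tm → Tm
P t = app PredF (t ∷ [])

MinusF : Fn 2
MinusF = rec (0 ∷ []) 1 2 (var 0) (P (var 2))

_-T_ : Tm → Tm → Tm
s -T t = app MinusF (s ∷ t ∷ [])

-- C is defined by recursion on its first argument; in the (last-argument)
-- scheme we use CF(u,v,w) with CF(u,v,0)=u, CF(u,v,Sw)=v and C(x,y,z)=CF(y,z,x).
CF : Fn 3
CF = rec (0 ∷ 1 ∷ []) 2 3 (var 0) (var 1)

C : Tm → Tm → Tm → Tm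
C x y z = app CF (y ∷ z ∷ x ∷ [])

EqT : Tm → Tm → Tm
EqT x y = (x -T y) +T (y -T x)

_≐̇_ : Tm → Tm → Tm
x ≐̇ y = C (EqT x y) zeroT 1T

¬̇ : Tm → Tm
¬̇ x = C x 1T zeroT

_∨̇_ : Tm → Tm → Tm
x ∨̇ y = C x zeroT (C y zeroT 1T)

χ : Fm → Tm
χ (s ≐ t) = s ≐̇ t
χ (¬' A) = ¬̇ (χ A)
χ (A ∨' B) = χ A ∨̇ χ B

TimesF : Fn 2
TimesF = rec (0 ∷ []) 1 2 zeroT (var 0 +T var 2)

_·T_ : Tm → Tm → Tm
s ·T t = app TimesF (s ∷ t ∷ [])

PowF : Fn 2
PowF = rec (0 ∷ []) 1 2 1T (var 0 ·T var 2)

_↑T_ : Tm → Tm → Tm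
s ↑T t = app PowF (s ∷ t ∷ [])

_≤F_ : Tm → Tm → Fm
s ≤F t = (s -T t) ≐ zeroT

_<F_ : Tm → Tm → Fm
s <F t = (s ≤F t) ∧' (¬' (s ≐ t))

-- bounded minimisation μ_A(ys, x) for formula A in variable x,
-- ys = the other variables of A (without repetition), z a fresh variable
otherVars : Fm → Var → List Var
otherVars A x = deduplicate _≟_ (filter (λ v → ¬? (v ≟ x)) (varsFm A))

freshVar : Fm → Var → Var
freshVar A x = suc (foldr _⊔_ x (varsFm A))

MuF : (A : Fm) (x : Var) → Fn (suc (length (otherVars A x)))
MuF A x = rec (fromList (otherVars A x)) x z
              (C (χ (substF x zeroT A)) zeroT 1T)
              (C (χ (var z ≤F var x)) (var z)
                 (C (χ (substF x (S (var x)) A)) (S (var x)) (S (S (var x)))))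
  where z = freshVar A x

μ : (A : Fm) (x : Var) → Tm → Tm
μ A x t = appRec (MuF A x) (fromList (otherVars A x)) t

-- ∃x≤b A  (b not containing x)
∃≤ : Var → Tm → Fm → Fm
∃≤ x b A = substF x (μ A x b) A

vx vq vu : Var
vx = 0
vq = 1
vu = 2

PowerOfTwo : Tm → Fm
PowerOfTwo q = ∃≤ vu q ((2T ↑T var vu) ≐ q)

BQ : Fm
BQ = PowerOfTwo (var vq) ∧' ((var vq ≤F S (var vx)) ∧' (S (var vx) <F (2T ·T var vq)))

Q : Tm → Tm
Q t = substT vx t (μ BQ vq (S (var vx)))

R : Tm → Tm
R t = S t -T Q t

_⊕_ : Tm → Tm → Tm
x ⊕ y = P ((S x ·T Q y) +T R y)

ε 0̄ 1̄ : Tm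
ε = zeroT
0̄ = 1T
1̄ = 2T

ParityF : Fn 1
ParityF = rec [] 0 1 zeroT (C (var 1) 1T zeroT)

Parity : Tm → Tm
Parity t = app ParityF (t ∷ [])

HalfF : Fn 1
HalfF = rec [] 0 1 zeroT (C (Parity (var 0)) (var 1) (S (var 1)))

Half : Tm → Tm
Half t = app HalfF (t ∷ [])

Chop : Tm → Tm
Chop t = P (Half (Q t) +T Half (R t))

fBody : (y z : Var) (b c : Tm) → Tm
fBody y z b c =
  C (χ (S (var y) ≐ (Chop (S (var y)) ⊕ 0̄)))
    (substT z (Chop (S (var y))) b)
    (C (χ (S (var y) ≐ (Chop (S (var y)) ⊕ 1̄)))
       (substT z (Chop (S (var y))) c)
       zeroT)

fSym : ∀ {n} (xs : Vec Var n) (y z : Var) (a b c : Tm) → Fn (suc n)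
fSym xs y z a b c = rec xs y z a (fBody y z b c)

{-# OPTIONS --safe #-}

-- In PRA, w ⊕ 0̄ = 2w + 1 and w ⊕ 1̄ = 2w + 2 because Q 1 = Q 2 = 2, and Chop inverts both: for
-- t = 2w + 1 or 2w + 2, Q t is a power of two 2h with h ≤ w + 1, so Half (Q t) = h,
-- Half (R t) = w + 1 ∸ h and Chop t = P (w + 1) = w.  Hence, at S y = w ⊕ 0̄ the first test of
-- the defining equation of f holds and selects b_z(w), while at S y = w ⊕ 1̄ it fails
-- (2w + 2 ≠ 2w + 1), the second holds and selects c_z(w).  The tests are decided through
-- χ A = 0 ↔ A, and the facts about Q rest on the least-witness property of bounded
-- minimisation, proved by induction on the bound.

module Submission where

open import Defs
open import Data.Nat using (ℕ; zero; suc; _+_; _∸_; _⊔_; _≟_; _≤_; _<_; s≤s)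
open import Data.Nat.Properties as ℕ using (m≤m⊔n; m≤n⊔m; <-irrefl; m≤m+n; m+n∸m≡n; 1+n≢n; m≤n⇒m≤1+n)
open import Data.Bool using (Bool; true; T; _∧_; if_then_else_)
open import Data.Bool.Properties using (T-∧)
open import Data.Empty using (⊥-elim)
open import Data.List using (List; []; _∷_; _++_; [_]; foldr; map; concatMap; filter)
open import Data.List.Membership.Propositional using (_∈_; _∉_)
open import Data.List.Membership.Propositional.Properties
  using (∈-++⁺ˡ; ∈-++⁺ʳ; ∈-++⁻; ∈-map⁺; ∈-map⁻; ∈-concatMap⁺; ∈-filter⁺; ∈-filter⁻; ∈-deduplicate⁺; ∈-deduplicate⁻)
open import Data.List.Membership.DecPropositional _≟_ using (_∈?_)
open import Data.List.Relation.Unary.All as All using (All; []; _∷_)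
open import Data.List.Relation.Unary.AllPairs using ([]; _∷_)
open import Data.List.Relation.Unary.Any as Any using (here; there)
open import Data.List.Relation.Unary.Any.Properties using (singleton⁻)
open import Data.List.Relation.Unary.Unique.Propositional using (Unique)
open import Data.List.Relation.Unary.Unique.DecPropositional _≟_ using (unique?)
open import Data.List.Relation.Unary.Unique.DecPropositional.Properties _≟_ using (deduplicate-!)
open import Data.Product using (∃; _×_; _,_; proj₁; proj₂)
open import Data.Sum using (_⊎_; inj₁; inj₂; [_,_]′)
open import Data.Vec as Vec using (Vec; []; _∷_; _∷ʳ_; toList; fromList)
open import Data.Vec.Properties using (toList∘fromList)
open import Function using (_∘_; Equivalence)
open import Relation.Binary.PropositionalEquality using (_≡_; _≢_; refl; sym; trans; cong; cong₂; subst; subst₂)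
open import Relation.Nullary using (Dec; yes; no; ¬?)
open import Relation.Nullary.Decidable using (⌊_⌋; True; toWitness)

infix 6 _↦_
infixr 9 _∘ₛ_

-- Substitution

cong₃ : ∀ {A B C D : Set} (f : A → B → C → D) {a a' b b' c c'} → a ≡ a' → b ≡ b' → c ≡ c' → f a b c ≡ f a' b' c'
cong₃ f refl refl refl = refl

Subst : Set
Subst = Var → Tm

update : Subst → Var → Tm → Subst
update σ x a v = if ⌊ v ≟ x ⌋ then a else σ v

_↦_ : Var → Tm → Subst
x ↦ a = update var x a

update-same : ∀ σ x a → update σ x a x ≡ a
update-same σ x a with x ≟ x
... | yes _ = refl
... | no x≢x = ⊥-elim (x≢x refl)

update-other : ∀ σ {x v} a → v ≢ x → update σ x a v ≡ σ v
update-other σ {x} {v} a v≢x with v ≟ x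
... | yes v≡x = ⊥-elim (v≢x v≡x)
... | no _ = refl

mutual
  sub : Subst → Tm → Tm
  sub σ (var v) = σ v
  sub σ (app f ts) = app f (subs σ ts)

  subs : ∀ {n} → Subst → Vec Tm n → Vec Tm n
  subs σ [] = []
  subs σ (t ∷ ts) = sub σ t ∷ subs σ ts

subF : Subst → Fm → Fm
subF σ (s ≐ t) = sub σ s ≐ sub σ t
subF σ (¬' A) = ¬' subF σ A
subF σ (A ∨' B) = subF σ A ∨' subF σ B

_∘ₛ_ : Subst → Subst → Subst
(σ ∘ₛ τ) v = sub σ (τ v)

mutual
  substT-↦ : ∀ x a t → substT x a t ≡ sub (x ↦ a) t
  substT-↦ x a (var v) = refl
  substT-↦ x a (app f ts) = cong (app f) (substV-↦ x a ts)

  substV-↦ : ∀ {n} x a (ts : Vec Tm n) → substV x a ts ≡ subs (x ↦ a) ts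
  substV-↦ x a [] = refl
  substV-↦ x a (t ∷ ts) = cong₂ _∷_ (substT-↦ x a t) (substV-↦ x a ts)

substF-↦ : ∀ x a A → substF x a A ≡ subF (x ↦ a) A
substF-↦ x a (s ≐ t) = cong₂ _≐_ (substT-↦ x a s) (substT-↦ x a t)
substF-↦ x a (¬' A) = cong ¬'_ (substF-↦ x a A)
substF-↦ x a (A ∨' B) = cong₂ _∨'_ (substF-↦ x a A) (substF-↦ x a B)

mutual
  sub-agree : ∀ {σ τ} t → (∀ {v} → v ∈ vars t → σ v ≡ τ v) → sub σ t ≡ sub τ t
  sub-agree (var v) eq = eq (here refl)
  sub-agree (app f ts) eq = cong (app f) (subs-agree ts eq)

  subs-agree : ∀ {n σ τ} (ts : Vec Tm n) → (∀ {v} → v ∈ varsV ts → σ v ≡ τ v) → subs σ ts ≡ subs τ ts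
  subs-agree [] eq = refl
  subs-agree (t ∷ ts) eq = cong₂ _∷_ (sub-agree t (eq ∘ ∈-++⁺ˡ)) (subs-agree ts (eq ∘ ∈-++⁺ʳ (vars t)))

subF-agree : ∀ {σ τ} A → (∀ {v} → v ∈ varsFm A → σ v ≡ τ v) → subF σ A ≡ subF τ A
subF-agree (s ≐ t) eq = cong₂ _≐_ (sub-agree s (eq ∘ ∈-++⁺ˡ)) (sub-agree t (eq ∘ ∈-++⁺ʳ (vars s)))
subF-agree (¬' A) eq = cong ¬'_ (subF-agree A eq)
subF-agree (A ∨' B) eq = cong₂ _∨'_ (subF-agree A (eq ∘ ∈-++⁺ˡ)) (subF-agree B (eq ∘ ∈-++⁺ʳ (varsFm A)))

mutual
  sub-∘ : ∀ σ τ t → sub σ (sub τ t) ≡ sub (σ ∘ₛ τ) t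
  sub-∘ σ τ (var v) = refl
  sub-∘ σ τ (app f ts) = cong (app f) (subs-∘ σ τ ts)

  subs-∘ : ∀ {n} σ τ (ts : Vec Tm n) → subs σ (subs τ ts) ≡ subs (σ ∘ₛ τ) ts
  subs-∘ σ τ [] = refl
  subs-∘ σ τ (t ∷ ts) = cong₂ _∷_ (sub-∘ σ τ t) (subs-∘ σ τ ts)

subF-∘ : ∀ σ τ A → subF σ (subF τ A) ≡ subF (σ ∘ₛ τ) A
subF-∘ σ τ (s ≐ t) = cong₂ _≐_ (sub-∘ σ τ s) (sub-∘ σ τ t)
subF-∘ σ τ (¬' A) = cong ¬'_ (subF-∘ σ τ A)
subF-∘ σ τ (A ∨' B) = cong₂ _∨'_ (subF-∘ σ τ A) (subF-∘ σ τ B)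

mutual
  sub-id : ∀ t → sub var t ≡ t
  sub-id (var v) = refl
  sub-id (app f ts) = cong (app f) (subs-id ts)

  subs-id : ∀ {n} (ts : Vec Tm n) → subs var ts ≡ ts
  subs-id [] = refl
  subs-id (t ∷ ts) = cong₂ _∷_ (sub-id t) (subs-id ts)

subF-id : ∀ A → subF var A ≡ A
subF-id (s ≐ t) = cong₂ _≐_ (sub-id s) (sub-id t)
subF-id (¬' A) = cong ¬'_ (subF-id A)
subF-id (A ∨' B) = cong₂ _∨'_ (subF-id A) (subF-id B)

sub-fixes : ∀ σ t → (∀ {v} → v ∈ vars t → σ v ≡ var v) → sub σ t ≡ t
sub-fixes σ t fix = trans (sub-agree t fix) (sub-id t)

subF-fixes : ∀ σ A → (∀ {v} → v ∈ varsFm A → σ v ≡ var v) → subF σ A ≡ A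
subF-fixes σ A fix = trans (subF-agree A fix) (subF-id A)

mutual
  vars-sub : ∀ σ t {v} → v ∈ vars (sub σ t) → ∃ λ u → u ∈ vars t × v ∈ vars (σ u)
  vars-sub σ (var u) p = u , here refl , p
  vars-sub σ (app f ts) p = vars-subs σ ts p

  vars-subs : ∀ {n} σ (ts : Vec Tm n) {v} → v ∈ varsV (subs σ ts) → ∃ λ u → u ∈ varsV ts × v ∈ vars (σ u)
  vars-subs σ (t ∷ ts) p with ∈-++⁻ (vars (sub σ t)) p
  ... | inj₁ q = let u , u∈t , v∈σu = vars-sub σ t q in u , ∈-++⁺ˡ u∈t , v∈σu
  ... | inj₂ q = let u , u∈ts , v∈σu = vars-subs σ ts q in u , ∈-++⁺ʳ (vars t) u∈ts , v∈σu

vars-subF : ∀ σ A {v} → v ∈ varsFm (subF σ A) → ∃ λ u → u ∈ varsFm A × v ∈ vars (σ u)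
vars-subF σ (s ≐ t) p with ∈-++⁻ (vars (sub σ s)) p
... | inj₁ q = let u , u∈s , v∈σu = vars-sub σ s q in u , ∈-++⁺ˡ u∈s , v∈σu
... | inj₂ q = let u , u∈t , v∈σu = vars-sub σ t q in u , ∈-++⁺ʳ (vars s) u∈t , v∈σu
vars-subF σ (¬' A) p = vars-subF σ A p
vars-subF σ (A ∨' B) p with ∈-++⁻ (varsFm (subF σ A)) p
... | inj₁ q = let u , u∈A , v∈σu = vars-subF σ A q in u , ∈-++⁺ˡ u∈A , v∈σu
... | inj₂ q = let u , u∈B , v∈σu = vars-subF σ B q in u , ∈-++⁺ʳ (varsFm A) u∈B , v∈σu

vars-substT : ∀ x a t {v} → v ∈ vars (substT x a t) → v ∈ vars a ⊎ (v ∈ vars t × v ≢ x)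
vars-substT x a t {v} p with vars-sub (x ↦ a) t (subst (λ r → v ∈ vars r) (substT-↦ x a t) p)
... | u , u∈t , q with u ≟ x
...   | yes refl = inj₁ q
...   | no u≢x with q
...     | here refl = inj₂ (u∈t , u≢x)

vars-substF : ∀ x a A {v} → v ∈ varsFm (substF x a A) → v ∈ vars a ⊎ (v ∈ varsFm A × v ≢ x)
vars-substF x a A {v} p with vars-subF (x ↦ a) A (subst (λ F → v ∈ varsFm F) (substF-↦ x a A) p)
... | u , u∈A , q with u ≟ x
...   | yes refl = inj₁ q
...   | no u≢x with q
...     | here refl = inj₂ (u∈A , u≢x)

WFSubst : Subst → Set
WFSubst σ = ∀ v → WFTm (σ v)

mutual
  wf-sub : ∀ {σ t} → WFSubst σ → WFTm t → WFTm (sub σ t)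
  wf-sub {σ} {var v} wσ _ = wσ v
  wf-sub wσ (wf-app wf wts) = wf-app wf (wf-subs wσ wts)

  wf-subs : ∀ {n σ} {ts : Vec Tm n} → WFSubst σ → WFTms ts → WFTms (subs σ ts)
  wf-subs wσ wf-[] = wf-[]
  wf-subs wσ (wf-∷ wt wts) = wf-∷ (wf-sub wσ wt) (wf-subs wσ wts)

wf-subF : ∀ {σ A} → WFSubst σ → WFFm A → WFFm (subF σ A)
wf-subF wσ (wf-eq ws wt) = wf-eq (wf-sub wσ ws) (wf-sub wσ wt)
wf-subF wσ (wf-neg wA) = wf-neg (wf-subF wσ wA)
wf-subF wσ (wf-or wA wB) = wf-or (wf-subF wσ wA) (wf-subF wσ wB)

wf-update : ∀ {σ x a} → WFSubst σ → WFTm a → WFSubst (update σ x a)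
wf-update {σ} {x} wσ wa v with v ≟ x
... | yes _ = wa
... | no _ = wσ v

wf-↦ : ∀ {x a} → WFTm a → WFSubst (x ↦ a)
wf-↦ = wf-update wf-var

wf-substT : ∀ {x a t} → WFTm a → WFTm t → WFTm (substT x a t)
wf-substT {x} {a} {t} wa wt = subst WFTm (sym (substT-↦ x a t)) (wf-sub (wf-↦ wa) wt)

wf-substF : ∀ {x a A} → WFTm a → WFFm A → WFFm (substF x a A)
wf-substF {x} {a} {A} wa wA = subst WFFm (sym (substF-↦ x a A)) (wf-subF (wf-↦ wa) wA)

sub-substT : ∀ σ x a t → (∀ {w} → w ∈ vars t → w ≢ x → σ w ≡ var w) → sub σ (substT x a t) ≡ substT x (sub σ a) t
sub-substT σ x a t fix =
  trans (cong (sub σ) (substT-↦ x a t)) (trans (sub-∘ σ (x ↦ a) t) (trans (sub-agree t agree) (sym (substT-↦ x (sub σ a) t))))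
  where
    agree : ∀ {w} → w ∈ vars t → (σ ∘ₛ (x ↦ a)) w ≡ (x ↦ sub σ a) w
    agree {w} w∈t with w ≟ x
    ... | yes _ = refl
    ... | no w≢x = fix w∈t w≢x

subF-substF : ∀ σ x a A → (∀ {w} → w ∈ varsFm A → w ≢ x → σ w ≡ var w) → subF σ (substF x a A) ≡ substF x (sub σ a) A
subF-substF σ x a A fix =
  trans (cong (subF σ) (substF-↦ x a A)) (trans (subF-∘ σ (x ↦ a) A) (trans (subF-agree A agree) (sym (substF-↦ x (sub σ a) A))))
  where
    agree : ∀ {w} → w ∈ varsFm A → (σ ∘ₛ (x ↦ a)) w ≡ (x ↦ sub σ a) w
    agree {w} w∈A with w ≟ x
    ... | yes _ = refl
    ... | no w≢x = fix w∈A w≢x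

sub-appRec : ∀ {n} σ (F : Fn (suc n)) (xs : Vec Var n) t → (∀ {v} → v ∈ toList xs → σ v ≡ var v) →
             sub σ (appRec F xs t) ≡ appRec F xs (sub σ t)
sub-appRec σ F xs t fix = cong (app F) (args xs fix)
  where
    args : ∀ {m} (vs : Vec Var m) → (∀ {v} → v ∈ toList vs → σ v ≡ var v) → subs σ (Vec.map var vs ∷ʳ t) ≡ Vec.map var vs ∷ʳ sub σ t
    args [] _ = refl
    args (v ∷ vs) fix = cong₂ _∷_ (fix (here refl)) (args vs (fix ∘ there))

-- Well-formedness and simultaneous instantiation

wf-S : ∀ {t} → WFTm t → WFTm (S t)
wf-S wt = wf-app wf-suc (wf-∷ wt wf-[])

wf-0 : WFTm zeroT
wf-0 = wf-app wf-zer wf-[]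

wf-⇒ : ∀ {A B} → WFFm A → WFFm B → WFFm (A ⇒ B)
wf-⇒ wA wB = wf-or (wf-neg wA) wB

wf-∧ : ∀ {A B} → WFFm A → WFFm B → WFFm (A ∧' B)
wf-∧ wA wB = wf-neg (wf-or (wf-neg wA) (wf-neg wB))

wf-∨ˡ : ∀ {A B} → WFFm (A ∨' B) → WFFm A
wf-∨ˡ (wf-or wA _) = wA

wf-∨ʳ : ∀ {A B} → WFFm (A ∨' B) → WFFm B
wf-∨ʳ (wf-or _ wB) = wB

wf-¬ : ∀ {A} → WFFm (¬' A) → WFFm A
wf-¬ (wf-neg wA) = wA

wf-premise : ∀ {A B} → WFFm (A ⇒ B) → WFFm A
wf-premise = wf-¬ ∘ wf-∨ˡ

wf-lhs : ∀ {s t} → WFFm (s ≐ t) → WFTm s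
wf-lhs (wf-eq ws _) = ws

wf-rhs : ∀ {s t} → WFFm (s ≐ t) → WFTm t
wf-rhs (wf-eq _ wt) = wt

wf-appRec : ∀ {n} {xs : Vec Var n} {y z a b t} → WFFn (rec xs y z a b) → WFTm t → WFTm (appRec (rec xs y z a b) xs t)
wf-appRec {xs = xs} wf wt = wf-app wf (args xs)
  where
    args : ∀ {m} (vs : Vec Var m) → WFTms (Vec.map var vs ∷ʳ _)
    args [] = wf-∷ wt wf-[]
    args (v ∷ vs) = wf-∷ (wf-var v) (args vs)

⊢⇒wf : ∀ {A} → ⊢ A → WFFm A
⊢⇒wf (ax-def0 wf@(wf-rec _ _ _ wa _)) = wf-eq (wf-appRec wf wf-0) wa
⊢⇒wf (ax-defS wf@(wf-rec _ _ _ _ wb)) = wf-eq (wf-appRec wf (wf-S (wf-var _))) (wf-substT (wf-appRec wf (wf-var _)) wb)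
⊢⇒wf (ax-S≠0 x) = wf-neg (wf-eq (wf-S (wf-var x)) wf-0)
⊢⇒wf (ax-Sinj x y) = wf-⇒ (wf-eq (wf-S (wf-var x)) (wf-S (wf-var y))) (wf-eq (wf-var x) (wf-var y))
⊢⇒wf (ax-refl x) = wf-eq (wf-var x) (wf-var x)
⊢⇒wf (ax-sym x y) = wf-⇒ (wf-eq (wf-var x) (wf-var y)) (wf-eq (wf-var y) (wf-var x))
⊢⇒wf (ax-eq x y A wA) = wf-⇒ (wf-∧ (wf-eq (wf-var x) (wf-var y)) wA) (wf-substF (wf-var y) wA)
⊢⇒wf (ax-contr A wA) = wf-⇒ (wf-or wA wA) wA
⊢⇒wf (ax-weak A B wA wB) = wf-⇒ wA (wf-or wA wB)
⊢⇒wf (ax-perm A B wA wB) = wf-⇒ (wf-or wA wB) (wf-or wB wA)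
⊢⇒wf (ax-assoc A B C wA wB wC) = wf-⇒ (wf-⇒ wB wC) (wf-⇒ (wf-or wA wB) (wf-or wA wC))
⊢⇒wf (r-inst x a wa p) = wf-substF wa (⊢⇒wf p)
⊢⇒wf (r-mp _ p⇒q) = wf-∨ʳ (⊢⇒wf p⇒q)
⊢⇒wf (r-ind x _ step) = wf-premise (⊢⇒wf step)

⊢-≡ : ∀ {A B} → A ≡ B → ⊢ A → ⊢ B
⊢-≡ refl p = p

⊢-↦ : ∀ {A} x a → WFTm a → ⊢ A → ⊢ subF (x ↦ a) A
⊢-↦ {A} x a wa p = ⊢-≡ (substF-↦ x a A) (r-inst x a wa p)

restrict : List Var → Subst → Subst
restrict L σ u with u ∈? L
... | yes _ = σ u
... | no _ = var u

restrict-∈ : ∀ L σ {u} → u ∈ L → restrict L σ u ≡ σ u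
restrict-∈ L σ {u} u∈L with u ∈? L
... | yes _ = refl
... | no u∉L = ⊥-elim (u∉L u∈L)

restrict-∉ : ∀ L σ {u} → u ∉ L → restrict L σ u ≡ var u
restrict-∉ L σ {u} u∉L with u ∈? L
... | yes u∈L = ⊥-elim (u∉L u∈L)
... | no _ = refl

Avoids : List Var → Subst → Set
Avoids L σ = ∀ {v} → v ∈ L → ∀ {u} → u ∈ vars (σ v) → u ∉ L

⊢-restrict : ∀ L σ → WFSubst σ → Avoids L σ → ∀ {A} → ⊢ A → ⊢ subF (restrict L σ) A
⊢-restrict [] σ wσ avoid {A} p = ⊢-≡ (sym (subF-fixes (restrict [] σ) A λ _ → restrict-∉ [] σ λ ())) p
⊢-restrict (v ∷ L) σ wσ avoid {A} p =
  ⊢-≡ (trans (subF-∘ (restrict L σ) (v ↦ σ v) A) (subF-agree A λ {u} _ → step u))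
      (⊢-restrict L σ wσ (λ v∈L u∈σv → avoid (there v∈L) u∈σv ∘ there) (⊢-↦ v (σ v) (wσ v) p))
  where
    step : ∀ u → (restrict L σ ∘ₛ (v ↦ σ v)) u ≡ restrict (v ∷ L) σ u
    step u = pointwise (u ≟ v) (u ∈? L)
      where
        pointwise : Dec (u ≡ v) → Dec (u ∈ L) → (restrict L σ ∘ₛ (v ↦ σ v)) u ≡ restrict (v ∷ L) σ u
        pointwise (yes refl) _ =
          trans (cong (sub (restrict L σ)) (update-same var u (σ u)))
                (trans (sub-fixes (restrict L σ) (σ u) λ w∈σu → restrict-∉ L σ (avoid (here refl) w∈σu ∘ there))
                       (sym (restrict-∈ (u ∷ L) σ (here refl))))
        pointwise (no u≢v) (yes u∈L) =
          trans (cong (sub (restrict L σ)) (update-other var (σ v) u≢v))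
                (trans (restrict-∈ L σ u∈L) (sym (restrict-∈ (v ∷ L) σ (there u∈L))))
        pointwise (no u≢v) (no u∉L) =
          trans (cong (sub (restrict L σ)) (update-other var (σ v) u≢v))
                (trans (restrict-∉ L σ u∉L) (sym (restrict-∉ (v ∷ L) σ λ { (here u≡v) → u≢v u≡v ; (there u∈L) → u∉L u∈L })))

seed≤foldr-⊔ : ∀ d L → d ≤ foldr _⊔_ d L
seed≤foldr-⊔ d [] = ℕ.≤-refl
seed≤foldr-⊔ d (u ∷ L) = ℕ.≤-trans (seed≤foldr-⊔ d L) (m≤n⊔m u (foldr _⊔_ d L))

∈⇒≤foldr-⊔ : ∀ d {v L} → v ∈ L → v ≤ foldr _⊔_ d L
∈⇒≤foldr-⊔ d {L = u ∷ L} (here refl) = m≤m⊔n u (foldr _⊔_ d L)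
∈⇒≤foldr-⊔ d {L = u ∷ L} (there p) = ℕ.≤-trans (∈⇒≤foldr-⊔ d p) (m≤n⊔m u (foldr _⊔_ d L))

-- Substituting one variable at a time could capture, so the variables of A are first renamed apart (u ↦ N + u).
⊢-sub : ∀ σ → WFSubst σ → ∀ {A} → ⊢ A → ⊢ subF σ A
⊢-sub σ wσ {A} p = ⊢-≡ renamed-back (⊢-restrict shifted σ∸N (wσ ∘ (_∸ N)) avoid₂ (⊢-restrict L +N (λ _ → wf-var _) avoid₁ p))
  where
    L = varsFm A
    N = suc (foldr _⊔_ 0 (L ++ concatMap (vars ∘ σ) L))
    +N σ∸N : Subst
    +N u = var (N + u)
    σ∸N u = σ (u ∸ N)
    shifted = map (N +_) L
    below : ∀ {u} → u ∈ L → u < N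
    below u∈L = s≤s (∈⇒≤foldr-⊔ 0 (∈-++⁺ˡ u∈L))
    below-σ : ∀ {v u} → v ∈ L → u ∈ vars (σ v) → u < N
    below-σ v∈L u∈σv = s≤s (∈⇒≤foldr-⊔ 0 (∈-++⁺ʳ L (∈-concatMap⁺ (vars ∘ σ) (Any.map (λ { refl → u∈σv }) v∈L))))
    avoid₁ : Avoids L +N
    avoid₁ {v} _ (here refl) N+v∈L = <-irrefl refl (ℕ.≤-trans (below N+v∈L) (m≤m+n N v))
    avoid₂ : Avoids shifted σ∸N
    avoid₂ v∈shifted u∈σ u∈shifted with ∈-map⁻ (N +_) v∈shifted | ∈-map⁻ (N +_) u∈shifted
    ... | v , v∈L , refl | u , _ , refl =
      <-irrefl refl (ℕ.≤-trans (below-σ v∈L (subst (λ k → _ ∈ vars (σ k)) (m+n∸m≡n N v) u∈σ)) (m≤m+n N u))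
    renamed-back : subF (restrict shifted σ∸N) (subF (restrict L +N) A) ≡ subF σ A
    renamed-back = trans (subF-∘ _ _ A) (subF-agree A λ {u} u∈A →
      trans (cong (sub (restrict shifted σ∸N)) (restrict-∈ L +N u∈A))
            (trans (restrict-∈ shifted σ∸N (∈-map⁺ (N +_) u∈A)) (cong σ (m+n∸m≡n N u))))

-- Propositional calculus

wf-premise⊢ : ∀ {A B} → ⊢ A ⇒ B → WFFm A
wf-premise⊢ = wf-premise ∘ ⊢⇒wf

wf-conclusion⊢ : ∀ {A B} → ⊢ A ⇒ B → WFFm B
wf-conclusion⊢ = wf-∨ʳ ∘ ⊢⇒wf

∨-monoʳ : ∀ {B C} A → WFFm A → ⊢ B ⇒ C → ⊢ (A ∨' B) ⇒ (A ∨' C)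
∨-monoʳ A wA p = r-mp p (ax-assoc A _ _ wA (wf-premise⊢ p) (wf-conclusion⊢ p))

⇒-trans : ∀ {A B C} → ⊢ A ⇒ B → ⊢ B ⇒ C → ⊢ A ⇒ C
⇒-trans p q = r-mp p (∨-monoʳ _ (wf-neg (wf-premise⊢ p)) q)

⇒-refl : ∀ {A} → WFFm A → ⊢ A ⇒ A
⇒-refl wA = ⇒-trans (ax-weak _ _ wA wA) (ax-contr _ wA)

excluded-middle : ∀ {A} → WFFm A → ⊢ A ∨' ¬' A
excluded-middle wA = r-mp (⇒-refl wA) (ax-perm _ _ (wf-neg wA) wA)

∨-comm : ∀ {A B} → ⊢ A ∨' B → ⊢ B ∨' A
∨-comm p = r-mp p (ax-perm _ _ (wf-∨ˡ (⊢⇒wf p)) (wf-∨ʳ (⊢⇒wf p)))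

∨-injʳ : ∀ {A B} → WFFm A → WFFm B → ⊢ B ⇒ (A ∨' B)
∨-injʳ wA wB = ⇒-trans (ax-weak _ _ wB wA) (ax-perm _ _ wB wA)

∨-monoˡ : ∀ {A A'} B → WFFm B → ⊢ A ⇒ A' → ⊢ (A ∨' B) ⇒ (A' ∨' B)
∨-monoˡ B wB p = ⇒-trans (ax-perm _ _ (wf-premise⊢ p) wB) (⇒-trans (∨-monoʳ B wB p) (ax-perm _ _ wB (wf-conclusion⊢ p)))

∨-case : ∀ {A B C} → ⊢ A ⇒ C → ⊢ B ⇒ C → ⊢ (A ∨' B) ⇒ C
∨-case p q = ⇒-trans (∨-monoʳ _ (wf-premise⊢ p) q)
  (⇒-trans (ax-perm _ _ (wf-premise⊢ p) (wf-conclusion⊢ q)) (⇒-trans (∨-monoʳ _ (wf-conclusion⊢ q) p) (ax-contr _ (wf-conclusion⊢ q))))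

¬¬-intro : ∀ {A} → WFFm A → ⊢ A ⇒ ¬' ¬' A
¬¬-intro wA = excluded-middle (wf-neg wA)

¬¬-elim : ∀ {A} → WFFm A → ⊢ (¬' ¬' A) ⇒ A
¬¬-elim wA = ∨-comm (r-mp (excluded-middle wA) (∨-monoʳ _ wA (¬¬-intro (wf-neg wA))))

∨-assocʳ : ∀ {A B C} → WFFm A → WFFm B → WFFm C → ⊢ ((A ∨' B) ∨' C) ⇒ (A ∨' (B ∨' C))
∨-assocʳ wA wB wC = ∨-case (∨-monoʳ _ wA (ax-weak _ _ wB wC)) (⇒-trans (∨-injʳ wB wC) (∨-injʳ wA (wf-or wB wC)))

∨-assocˡ : ∀ {A B C} → WFFm A → WFFm B → WFFm C → ⊢ (A ∨' (B ∨' C)) ⇒ ((A ∨' B) ∨' C)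
∨-assocˡ wA wB wC = ∨-case (⇒-trans (ax-weak _ _ wA wB) (ax-weak _ _ (wf-or wA wB) wC))
  (∨-case (⇒-trans (∨-injʳ wA wB) (ax-weak _ _ (wf-or wA wB) wC)) (∨-injʳ (wf-or wA wB) wC))

∨-exchange : ∀ {A B C} → WFFm A → WFFm B → WFFm C → ⊢ (A ∨' (B ∨' C)) ⇒ (B ∨' (A ∨' C))
∨-exchange wA wB wC = ∨-case (⇒-trans (ax-weak _ _ wA wC) (∨-injʳ wB (wf-or wA wC))) (∨-monoʳ _ wB (∨-injʳ wA wC))

⇒-const : ∀ {A B} → WFFm A → WFFm B → ⊢ A ⇒ (B ⇒ A)
⇒-const wA wB = ∨-injʳ (wf-neg wB) wA

⇒-flip : ∀ {A B C} → ⊢ A ⇒ (B ⇒ C) → ⊢ B ⇒ (A ⇒ C)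
⇒-flip p with ⊢⇒wf p
... | wf-or (wf-neg wA) (wf-or (wf-neg wB) wC) = r-mp p (∨-exchange (wf-neg wA) (wf-neg wB) wC)

⇒-compose : ∀ {A B C} → WFFm A → WFFm B → WFFm C → ⊢ (B ⇒ C) ⇒ ((A ⇒ B) ⇒ (A ⇒ C))
⇒-compose wA wB wC = ax-assoc _ _ _ (wf-neg wA) wB wC

⇒-contract : ∀ {A C} → WFFm A → WFFm C → ⊢ (A ⇒ (A ⇒ C)) ⇒ (A ⇒ C)
⇒-contract wA wC = ⇒-trans (∨-assocˡ (wf-neg wA) (wf-neg wA) wC) (∨-monoˡ _ wC (ax-contr _ (wf-neg wA)))

⇒-distrib : ∀ {A B C} → WFFm A → WFFm B → WFFm C → ⊢ (A ⇒ (B ⇒ C)) ⇒ ((A ⇒ B) ⇒ (A ⇒ C))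
⇒-distrib wA wB wC = ⇒-flip (⇒-trans (⇒-trans chain compose) contract)
  where
    chain = ⇒-flip (⇒-compose wA wB wC)
    compose = ⇒-compose wA (wf-⇒ wB wC) (wf-⇒ wA wC)
    contract = r-mp (⇒-contract wA wC) (⇒-compose (wf-⇒ wA (wf-⇒ wB wC)) (wf-⇒ wA (wf-⇒ wA wC)) (wf-⇒ wA wC))

contraposition : ∀ {A B} → ⊢ A ⇒ B → ⊢ (¬' B) ⇒ (¬' A)
contraposition p = ∨-comm (r-mp p (∨-monoʳ _ (wf-neg (wf-premise⊢ p)) (¬¬-intro (wf-conclusion⊢ p))))

∧-intro⊢ : ∀ {A B} → WFFm A → WFFm B → ⊢ A ⇒ (B ⇒ (A ∧' B))
∧-intro⊢ wA wB = r-mp (excluded-middle (wf-or (wf-neg wA) (wf-neg wB)))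
  (∨-assocʳ (wf-neg wA) (wf-neg wB) (wf-neg (wf-or (wf-neg wA) (wf-neg wB))))

infix 2 _⊩_
data _⊩_ (Γ : List Fm) : Fm → Set where
  hyp : ∀ {A} → A ∈ Γ → WFFm A → Γ ⊩ A
  thm : ∀ {A} → ⊢ A → Γ ⊩ A
  mp : ∀ {A B} → Γ ⊩ A → Γ ⊩ A ⇒ B → Γ ⊩ B

⊩⇒wf : ∀ {Γ A} → Γ ⊩ A → WFFm A
⊩⇒wf (hyp _ wA) = wA
⊩⇒wf (thm p) = ⊢⇒wf p
⊩⇒wf (mp _ p⇒q) = wf-∨ʳ (⊩⇒wf p⇒q)

deduction : ∀ {Γ A B} → WFFm B → (B ∷ Γ) ⊩ A → Γ ⊩ B ⇒ A
deduction wB (hyp (here refl) wA) = thm (⇒-refl wA)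
deduction wB (hyp (there A∈Γ) wA) = mp (hyp A∈Γ wA) (thm (⇒-const wA wB))
deduction wB (thm p) = mp (thm p) (thm (⇒-const (⊢⇒wf p) wB))
deduction wB (mp p p⇒q) = mp (deduction wB p) (mp (deduction wB p⇒q) (thm (⇒-distrib wB (⊩⇒wf p) (wf-∨ʳ (⊩⇒wf p⇒q)))))

closed : ∀ {A} → [] ⊩ A → ⊢ A
closed (thm p) = p
closed (mp p p⇒q) = r-mp (closed p) (closed p⇒q)

wk : ∀ {Γ A B} → Γ ⊩ A → (B ∷ Γ) ⊩ A
wk (hyp A∈Γ wA) = hyp (there A∈Γ) wA
wk (thm p) = thm p
wk (mp p p⇒q) = mp (wk p) (wk p⇒q)

assumption : ∀ {Γ A} → WFFm A → (A ∷ Γ) ⊩ A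
assumption = hyp (here refl)

∧-intro : ∀ {Γ A B} → Γ ⊩ A → Γ ⊩ B → Γ ⊩ A ∧' B
∧-intro p q = mp q (mp p (thm (∧-intro⊢ (⊩⇒wf p) (⊩⇒wf q))))

∧-proj₁ : ∀ {Γ A B} → Γ ⊩ A ∧' B → Γ ⊩ A
∧-proj₁ p with ⊩⇒wf p
... | wf-neg (wf-or (wf-neg wA) (wf-neg wB)) = mp p (thm (⇒-trans (contraposition (ax-weak _ _ (wf-neg wA) (wf-neg wB))) (¬¬-elim wA)))

∧-proj₂ : ∀ {Γ A B} → Γ ⊩ A ∧' B → Γ ⊩ B
∧-proj₂ p with ⊩⇒wf p
... | wf-neg (wf-or (wf-neg wA) (wf-neg wB)) = mp p (thm (⇒-trans (contraposition (∨-injʳ (wf-neg wA) (wf-neg wB))) (¬¬-elim wB)))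

∨-inj₁ : ∀ {Γ A B} → WFFm B → Γ ⊩ A → Γ ⊩ A ∨' B
∨-inj₁ wB p = mp p (thm (ax-weak _ _ (⊩⇒wf p) wB))

∨-inj₂ : ∀ {Γ A B} → WFFm A → Γ ⊩ B → Γ ⊩ A ∨' B
∨-inj₂ wA p = mp p (thm (∨-injʳ wA (⊩⇒wf p)))

∨-elim : ∀ {Γ A B C} → Γ ⊩ A ∨' B → (A ∷ Γ) ⊩ C → (B ∷ Γ) ⊩ C → Γ ⊩ C
∨-elim p q r = mp (mp (mp (mp p (mp (deduction wB r) (thm (ax-assoc _ _ _ wA wB wC)))) (thm (ax-perm _ _ wA wC)))
                      (mp (deduction wA q) (thm (ax-assoc _ _ _ wC wA wC))))
                  (thm (ax-contr _ wC))
  where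
    wA = wf-∨ˡ (⊩⇒wf p)
    wB = wf-∨ʳ (⊩⇒wf p)
    wC = ⊩⇒wf q

by-cases : ∀ {Γ A C} → WFFm A → (A ∷ Γ) ⊩ C → ((¬' A) ∷ Γ) ⊩ C → Γ ⊩ C
by-cases wA = ∨-elim (thm (excluded-middle wA))

ex-falso : ∀ {Γ A B} → WFFm B → Γ ⊩ A → Γ ⊩ ¬' A → Γ ⊩ B
ex-falso wB p ¬p = mp p (mp ¬p (thm (ax-weak _ _ (⊩⇒wf ¬p) wB)))

by-contradiction : ∀ {Γ A} → WFFm A → ((¬' A) ∷ Γ) ⊩ A → Γ ⊩ A
by-contradiction wA = by-cases wA (assumption wA)

¬-intro : ∀ {Γ A} → WFFm A → (A ∷ Γ) ⊩ ¬' A → Γ ⊩ ¬' A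
¬-intro wA p = by-cases wA p (assumption (wf-neg wA))

⇔-to : ∀ {Γ A B} → Γ ⊩ A ⇔ B → Γ ⊩ A → Γ ⊩ B
⇔-to A⇔B p = mp p (∧-proj₁ A⇔B)

⇔-from : ∀ {Γ A B} → Γ ⊩ A ⇔ B → Γ ⊩ B → Γ ⊩ A
⇔-from A⇔B q = mp q (∧-proj₂ A⇔B)

nthOr : List Tm → ℕ → Tm → Tm
nthOr [] v d = d
nthOr (t ∷ ts) zero d = t
nthOr (t ∷ ts) (suc v) d = nthOr ts v d

⟪_⟫ : List Tm → Subst
⟪ ts ⟫ v = nthOr ts v (var v)

wf-⟪⟫ : ∀ {ts} → All WFTm ts → WFSubst ⟪ ts ⟫
wf-⟪⟫ wts v = nth wts v
  where
    nth : ∀ {ts d} → All WFTm ts → ∀ u → WFTm (nthOr ts u (var d))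
    nth [] u = wf-var _
    nth (wt ∷ wts) zero = wt
    nth (wt ∷ wts) (suc u) = nth wts u

Unique-≢ : ∀ {y z : Var} {L} → Unique (y ∷ z ∷ L) → y ≢ z
Unique-≢ ((y≢z ∷ _) ∷ _) = y≢z

Unique-∉₀ : ∀ {y z : Var} {L v} → Unique (y ∷ z ∷ L) → v ∈ L → y ≢ v
Unique-∉₀ ((_ ∷ y∉L) ∷ _) v∈L = All.lookup y∉L v∈L

Unique-∉₁ : ∀ {y z : Var} {L v} → Unique (y ∷ z ∷ L) → v ∈ L → z ≢ v
Unique-∉₁ (_ ∷ (z∉L ∷ _)) v∈L = All.lookup z∉L v∈L

fresh : List Var → Var
fresh L = suc (foldr _⊔_ 0 L)

fresh-∉ : ∀ L → fresh L ∉ L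
fresh-∉ L p = <-irrefl refl (∈⇒≤foldr-⊔ 0 p)

suc-fresh-∉ : ∀ L → suc (fresh L) ∉ L
suc-fresh-∉ L p = <-irrefl refl (m≤n⇒m≤1+n (∈⇒≤foldr-⊔ 0 p))

mutual
  wf? : Tm → Bool
  wf? (var v) = true
  wf? (app f ts) = wfFn? f ∧ wfs? ts

  wfs? : ∀ {n} → Vec Tm n → Bool
  wfs? [] = true
  wfs? (t ∷ ts) = wf? t ∧ wfs? ts

  wfFn? : ∀ {n} → Fn n → Bool
  wfFn? zer = true
  wfFn? suc' = true
  wfFn? (rec xs y z a b) =
    ⌊ unique? (y ∷ z ∷ toList xs) ⌋ ∧ ⌊ All.all? (_∈? toList xs) (vars a) ⌋
    ∧ ⌊ All.all? (_∈? (y ∷ z ∷ toList xs)) (vars b) ⌋ ∧ wf? a ∧ wf? b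

T-∧⁻ : ∀ x {y} → T (x ∧ y) → T x × T y
T-∧⁻ x {y} = Equivalence.to (T-∧ {x} {y})

mutual
  wf?-sound : ∀ t → T (wf? t) → WFTm t
  wf?-sound (var v) _ = wf-var v
  wf?-sound (app f ts) ok = let okf , okts = T-∧⁻ (wfFn? f) ok in wf-app (wfFn?-sound f okf) (wfs?-sound ts okts)

  wfs?-sound : ∀ {n} (ts : Vec Tm n) → T (wfs? ts) → WFTms ts
  wfs?-sound [] _ = wf-[]
  wfs?-sound (t ∷ ts) ok = let okt , okts = T-∧⁻ (wf? t) ok in wf-∷ (wf?-sound t okt) (wfs?-sound ts okts)

  wfFn?-sound : ∀ {n} (f : Fn n) → T (wfFn? f) → WFFn f
  wfFn?-sound zer _ = wf-zer
  wfFn?-sound suc' _ = wf-suc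
  wfFn?-sound (rec xs y z a b) ok =
    let uniq , ok₁ = T-∧⁻ (⌊ unique? (y ∷ z ∷ toList xs) ⌋) ok
        ⊆a , ok₂ = T-∧⁻ ⌊ All.all? (_∈? toList xs) (vars a) ⌋ ok₁
        ⊆b , ok₃ = T-∧⁻ ⌊ All.all? (_∈? (y ∷ z ∷ toList xs)) (vars b) ⌋ ok₂
        oka , okb = T-∧⁻ (wf? a) ok₃
    in wf-rec (toWitness uniq) (toWitness ⊆a) (toWitness ⊆b) (wf?-sound a oka) (wf?-sound b okb)

wfF? : Fm → Bool
wfF? (s ≐ t) = wf? s ∧ wf? t
wfF? (¬' A) = wfF? A
wfF? (A ∨' B) = wfF? A ∧ wfF? B

wfF?-sound : ∀ A → T (wfF? A) → WFFm A
wfF?-sound (s ≐ t) ok = let oks , okt = T-∧⁻ (wf? s) ok in wf-eq (wf?-sound s oks) (wf?-sound t okt)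
wfF?-sound (¬' A) ok = wf-neg (wfF?-sound A ok)
wfF?-sound (A ∨' B) ok = let okA , okB = T-∧⁻ (wfF? A) ok in wf-or (wfF?-sound A okA) (wfF?-sound B okB)

-- On concrete syntax the implicit ok evaluates to tt, so Agda fills it in.
wf! : ∀ t {ok : T (wf? t)} → WFTm t
wf! t {ok} = wf?-sound t ok

wfF! : ∀ A {ok : T (wfF? A)} → WFFm A
wfF! A {ok} = wfF?-sound A ok

wfFn! : ∀ {n} (f : Fn n) {ok : T (wfFn? f)} → WFFn f
wfFn! f {ok} = wfFn?-sound f ok

at : Tm → Tm → Tm
at u t = sub ⟪ u ∷ [] ⟫ t

Only0 : Tm → Set
Only0 t = vars t ⊆ [ 0 ]

only0! : ∀ t {ok : True (All.all? (_∈? [ 0 ]) (vars t))} → Only0 t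
only0! t {ok} = toWitness ok

vars-at : ∀ {u t v} → Only0 t → v ∈ vars (at u t) → v ∈ vars u
vars-at {u} {t} only0 v∈ with vars-sub ⟪ u ∷ [] ⟫ t v∈
... | w , w∈t , v∈σw with All.lookup only0 w∈t
...   | here refl = v∈σw

sub-at : ∀ σ y t → Only0 t → sub σ (at (var y) t) ≡ at (σ y) t
sub-at σ y t only0 = trans (sub-∘ σ ⟪ var y ∷ [] ⟫ t) (sub-agree t λ w∈t → at-0 (All.lookup only0 w∈t))
  where
    at-0 : ∀ {w} → w ∈ [ 0 ] → (σ ∘ₛ ⟪ var y ∷ [] ⟫) w ≡ ⟪ σ y ∷ [] ⟫ w
    at-0 (here refl) = refl

-- Equality

⊢-⟪⟫ : ∀ ts → All WFTm ts → ∀ {A} → ⊢ A → ⊢ subF ⟪ ts ⟫ A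
⊢-⟪⟫ ts wts = ⊢-sub ⟪ ts ⟫ (wf-⟪⟫ wts)

≐-refl : ∀ {Γ t} → WFTm t → Γ ⊩ t ≐ t
≐-refl {t = t} wt = thm (⊢-⟪⟫ (t ∷ []) (wt ∷ []) (ax-refl 0))

≐-sym : ∀ {Γ s t} → Γ ⊩ s ≐ t → Γ ⊩ t ≐ s
≐-sym {s = s} {t} p with ⊩⇒wf p
... | wf-eq ws wt = mp p (thm (⊢-⟪⟫ (s ∷ t ∷ []) (ws ∷ wt ∷ []) (ax-sym 0 1)))

≐-trans : ∀ {Γ r s t} → Γ ⊩ r ≐ s → Γ ⊩ s ≐ t → Γ ⊩ r ≐ t
≐-trans {r = r} {s} {t} p q with ⊩⇒wf p | ⊩⇒wf q
... | wf-eq wr ws | wf-eq _ wt = mp q (mp p (thm (⊢-⟪⟫ (r ∷ s ∷ t ∷ []) (wr ∷ ws ∷ wt ∷ []) ≐-trans₀)))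
  where
    r≐s = wf-eq (wf-var 0) (wf-var 1)
    s≐t = wf-eq (wf-var 1) (wf-var 2)
    ≐-trans₀ : ⊢ (var 0 ≐ var 1) ⇒ ((var 1 ≐ var 2) ⇒ (var 0 ≐ var 2))
    ≐-trans₀ = closed (deduction r≐s (deduction s≐t
      (mp (∧-intro (≐-sym (wk (assumption r≐s))) (assumption s≐t)) (thm (ax-eq 1 0 (var 1 ≐ var 2) s≐t)))))

infixr 2 _▸_
_▸_ : ∀ {Γ r s t} → Γ ⊩ r ≐ s → Γ ⊩ s ≐ t → Γ ⊩ r ≐ t
_▸_ = ≐-trans

-- The axiom of equality only speaks of variables; they are chosen fresh for F and then instantiated simultaneously.
≐-subst⊢ : ∀ x F {s t} → WFFm F → WFTm s → WFTm t → ⊢ ((s ≐ t) ∧' substF x s F) ⇒ substF x t F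
≐-subst⊢ x F {s} {t} wF ws wt =
  ⊢-≡ instance-eq (⊢-sub σ (wf-update (wf-↦ wt) ws) (ax-eq u v (substF x (var u) F) (wf-substF (wf-var u) wF)))
  where
    u = fresh (varsFm F)
    v = suc u
    σ = update (v ↦ t) u s
    σ-fixes : ∀ {w} → w ∈ varsFm F → w ≢ x → σ w ≡ var w
    σ-fixes w∈F _ = trans (update-other (v ↦ t) s λ { refl → fresh-∉ (varsFm F) w∈F })
                          (update-other var t λ { refl → suc-fresh-∉ (varsFm F) w∈F })
    σu : σ u ≡ s
    σu = update-same (v ↦ t) u s
    σv : σ v ≡ t
    σv = trans (update-other (v ↦ t) {u} {v} s 1+n≢n) (update-same var v t)
    rename : substF u (var v) (substF x (var u) F) ≡ substF x (var v) F
    rename = trans (substF-↦ u (var v) (substF x (var u) F))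
      (trans (subF-substF (u ↦ var v) x (var u) F λ w∈F _ → update-other var (var v) λ { refl → fresh-∉ _ w∈F })
             (cong (λ a → substF x a F) (update-same var u (var v))))
    instance-eq : subF σ (((var u ≐ var v) ∧' substF x (var u) F) ⇒ substF u (var v) (substF x (var u) F))
                ≡ (((s ≐ t) ∧' substF x s F) ⇒ substF x t F)
    instance-eq = cong₃ (λ P Q R → (P ∧' Q) ⇒ R) (cong₂ _≐_ σu σv)
      (trans (subF-substF σ x (var u) F σ-fixes) (cong (λ a → substF x a F) σu))
      (trans (cong (subF σ) rename) (trans (subF-substF σ x (var v) F σ-fixes) (cong (λ a → substF x a F) σv)))

≐-subst : ∀ {Γ} x F {s t} → WFFm F → Γ ⊩ s ≐ t → Γ ⊩ substF x s F → Γ ⊩ substF x t F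
≐-subst x F wF s≐t p with ⊩⇒wf s≐t
... | wf-eq ws wt = mp (∧-intro s≐t p) (thm (≐-subst⊢ x F wF ws wt))

≐-cong : ∀ {Γ} r x {s t} → WFTm r → Γ ⊩ s ≐ t → Γ ⊩ substT x s r ≐ substT x t r
≐-cong {Γ} r x {s} {t} wr s≐t =
  ⊢≡ (plug t) (≐-subst u F (wf-eq (wf-substT ws wr) (wf-substT (wf-var u) wr)) s≐t (⊢≡ (sym (plug s)) (≐-refl (wf-substT ws wr))))
  where
    ws = wf-lhs (⊩⇒wf s≐t)
    u = fresh (vars r ++ vars s)
    u∉r : u ∉ vars r
    u∉r = fresh-∉ _ ∘ ∈-++⁺ˡ
    u∉s : u ∉ vars s
    u∉s = fresh-∉ _ ∘ ∈-++⁺ʳ (vars r)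
    F = substT x s r ≐ substT x (var u) r
    ⊢≡ : ∀ {A B} → A ≡ B → Γ ⊩ A → Γ ⊩ B
    ⊢≡ refl p = p
    fixes-r : ∀ a {w} → w ∈ vars r → w ≢ x → (u ↦ a) w ≡ var w
    fixes-r a w∈r _ = update-other var a λ { refl → u∉r w∈r }
    plug : ∀ a → substF u a F ≡ (substT x s r ≐ substT x a r)
    plug a = cong₂ _≐_
      (trans (substT-↦ u a (substT x s r)) (trans (sub-substT (u ↦ a) x s r (fixes-r a))
             (cong (λ b → substT x b r) (sub-fixes (u ↦ a) s λ w∈s → update-other var a λ { refl → u∉s w∈s }))))
      (trans (substT-↦ u a (substT x (var u) r)) (trans (sub-substT (u ↦ a) x (var u) r (fixes-r a)) (cong (λ b → substT x b r) (update-same var u a))))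

wfList? : List Tm → Bool
wfList? = foldr (λ t b → wf? t ∧ b) true

wfList?-sound : ∀ ts → T (wfList? ts) → All WFTm ts
wfList?-sound [] _ = []
wfList?-sound (t ∷ ts) ok = let okt , okts = T-∧⁻ (wf? t) ok in wf?-sound t okt ∷ wfList?-sound ts okts

use : ∀ {Γ A} ts {ok : T (wfList? ts)} → ⊢ A → Γ ⊩ subF ⟪ ts ⟫ A
use ts {ok} p = thm (⊢-⟪⟫ ts (wfList?-sound ts ok) p)

use′ : ∀ {Γ A} ts → All WFTm ts → ⊢ A → Γ ⊩ subF ⟪ ts ⟫ A
use′ ts wts p = thm (⊢-⟪⟫ ts wts p)

#0 : ∀ {Γ A} {ok : T (wfF? A)} → (A ∷ Γ) ⊩ A
#0 {A = A} {ok} = assumption (wfF?-sound A ok)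

#1 : ∀ {Γ A B} {ok : T (wfF? A)} → (B ∷ A ∷ Γ) ⊩ A
#1 {ok = ok} = wk (#0 {ok = ok})

#2 : ∀ {Γ A B C} {ok : T (wfF? A)} → (C ∷ B ∷ A ∷ Γ) ⊩ A
#2 {ok = ok} = wk (#1 {ok = ok})

#3 : ∀ {Γ A B C D} {ok : T (wfF? A)} → (D ∷ C ∷ B ∷ A ∷ Γ) ⊩ A
#3 {ok = ok} = wk (#2 {ok = ok})

-- The hole of a context: concrete terms below only use variables smaller than 100.
□ : Tm
□ = var 100

under : ∀ {Γ s t} r {ok : T (wf? r)} → Γ ⊩ s ≐ t → Γ ⊩ substT 100 s r ≐ substT 100 t r
under r {ok} = ≐-cong r 100 (wf?-sound r ok)

⇒-intro : ∀ {Γ A B} {ok : T (wfF? B)} → (B ∷ Γ) ⊩ A → Γ ⊩ B ⇒ A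
⇒-intro {B = B} {ok} = deduction (wfF?-sound B ok)

induction : ∀ x A {ok : T (wfF? A)} → [] ⊩ substF x zeroT A → (A ∷ []) ⊩ substF x (S (var x)) A → ⊢ A
induction x A {ok} base step = r-ind x (closed base) (closed (deduction (wfF?-sound A ok) step))

cases-on : ∀ {Γ C} A {ok : T (wfF? A)} → (A ∷ Γ) ⊩ C → ((¬' A) ∷ Γ) ⊩ C → Γ ⊩ C
cases-on A {ok} = by-cases (wfF?-sound A ok)

absurd : ∀ {Γ A B} {ok : T (wfF? B)} → Γ ⊩ A → Γ ⊩ ¬' A → Γ ⊩ B
absurd {B = B} {ok} = ex-falso (wfF?-sound B ok)

S≢0 : ∀ {Γ t} → WFTm t → Γ ⊩ ¬' (S t ≐ zeroT)
S≢0 {t = t} wt = use′ (t ∷ []) (wt ∷ []) (ax-S≠0 0)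

-- Arithmetic

v0 v1 v2 v3 : Tm
v0 = var 0
v1 = var 1
v2 = var 2
v3 = var 3

+-identityʳ : ⊢ (v0 +T zeroT) ≐ v0
+-identityʳ = ax-def0 (wfFn! PlusF)
+-suc : ⊢ (v0 +T S v1) ≐ S (v0 +T v1)
+-suc = ax-defS (wfFn! PlusF)
P-0 : ⊢ P zeroT ≐ zeroT
P-0 = ax-def0 (wfFn! PredF)
P-S : ⊢ P (S v1) ≐ v1
P-S = ax-defS (wfFn! PredF)
∸-identityʳ : ⊢ (v0 -T zeroT) ≐ v0
∸-identityʳ = ax-def0 (wfFn! MinusF)
∸-suc : ⊢ (v0 -T S v1) ≐ P (v0 -T v1)
∸-suc = ax-defS (wfFn! MinusF)
C-0 : ⊢ C zeroT v0 v1 ≐ v0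
C-0 = ax-def0 (wfFn! CF)
C-S : ⊢ C (S v2) v0 v1 ≐ v1
C-S = ax-defS (wfFn! CF)
*-zeroʳ : ⊢ (v0 ·T zeroT) ≐ zeroT
*-zeroʳ = ax-def0 (wfFn! TimesF)
*-suc : ⊢ (v0 ·T S v1) ≐ (v0 +T (v0 ·T v1))
*-suc = ax-defS (wfFn! TimesF)
^-0 : ⊢ (v0 ↑T zeroT) ≐ 1T
^-0 = ax-def0 (wfFn! PowF)
^-suc : ⊢ (v0 ↑T S v1) ≐ (v0 ·T (v0 ↑T v1))
^-suc = ax-defS (wfFn! PowF)
Parity-0 : ⊢ Parity zeroT ≐ zeroT
Parity-0 = ax-def0 (wfFn! ParityF)
Parity-S : ⊢ Parity (S v0) ≐ C (Parity v0) 1T zeroT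
Parity-S = ax-defS (wfFn! ParityF)
Half-0 : ⊢ Half zeroT ≐ zeroT
Half-0 = ax-def0 (wfFn! HalfF)
Half-S : ⊢ Half (S v0) ≐ C (Parity v0) (Half v0) (S (Half v0))
Half-S = ax-defS (wfFn! HalfF)

+-identityˡ : ⊢ (zeroT +T v0) ≐ v0
+-identityˡ = induction 0 _ (use (zeroT ∷ []) +-identityʳ)
  (use (zeroT ∷ v0 ∷ []) +-suc ▸ under (S □) #0)

suc-+ : ⊢ (S v0 +T v1) ≐ S (v0 +T v1)
suc-+ = induction 1 _ (use (S v0 ∷ []) +-identityʳ ▸ under (S □) (≐-sym (use (v0 ∷ []) +-identityʳ)))
  (use (S v0 ∷ v1 ∷ []) +-suc ▸ under (S □) #0 ▸ ≐-sym (under (S □) (use (v0 ∷ v1 ∷ []) +-suc)))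

+-comm : ⊢ (v0 +T v1) ≐ (v1 +T v0)
+-comm = induction 1 _ (use (v0 ∷ []) +-identityʳ ▸ ≐-sym (use (v0 ∷ []) +-identityˡ))
  (use (v0 ∷ v1 ∷ []) +-suc ▸ under (S □) #0 ▸ ≐-sym (use (v1 ∷ v0 ∷ []) suc-+))

+-assoc : ⊢ ((v0 +T v1) +T v2) ≐ (v0 +T (v1 +T v2))
+-assoc = induction 2 _ (use (v0 +T v1 ∷ []) +-identityʳ ▸ ≐-sym (under (v0 +T □) (use (v1 ∷ []) +-identityʳ)))
  (use (v0 +T v1 ∷ v2 ∷ []) +-suc ▸ under (S □) #0 ▸ ≐-sym (use (v0 ∷ v1 +T v2 ∷ []) +-suc)
    ▸ ≐-sym (under (v0 +T □) (use (v1 ∷ v2 ∷ []) +-suc)))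

0∸x≐0 : ⊢ (zeroT -T v0) ≐ zeroT
0∸x≐0 = induction 0 _ (use (zeroT ∷ []) ∸-identityʳ)
  (use (zeroT ∷ v0 ∷ []) ∸-suc ▸ under (P □) #0 ▸ thm P-0)

Sx∸Sy≐x∸y : ⊢ (S v0 -T S v1) ≐ (v0 -T v1)
Sx∸Sy≐x∸y = induction 1 _
  (use (S v0 ∷ zeroT ∷ []) ∸-suc ▸ under (P □) (use (S v0 ∷ []) ∸-identityʳ) ▸ use (zeroT ∷ v0 ∷ []) P-S ▸ ≐-sym (use (v0 ∷ []) ∸-identityʳ))
  (use (S v0 ∷ S v1 ∷ []) ∸-suc ▸ under (P □) #0 ▸ ≐-sym (use (v0 ∷ v1 ∷ []) ∸-suc))

x∸x≐0 : ⊢ (v0 -T v0) ≐ zeroT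
x∸x≐0 = induction 0 _ (use (zeroT ∷ []) ∸-identityʳ) (use (v0 ∷ v0 ∷ []) Sx∸Sy≐x∸y ▸ #0)

Sx∸x≐1 : ⊢ (S v0 -T v0) ≐ 1T
Sx∸x≐1 = induction 0 _ (use (S zeroT ∷ []) ∸-identityʳ) (use (S v0 ∷ v0 ∷ []) Sx∸Sy≐x∸y ▸ #0)

Px∸y≐P[x∸y] : ⊢ (P v0 -T v1) ≐ P (v0 -T v1)
Px∸y≐P[x∸y] = induction 1 _ (use (P v0 ∷ []) ∸-identityʳ ▸ ≐-sym (under (P □) (use (v0 ∷ []) ∸-identityʳ)))
  (use (P v0 ∷ v1 ∷ []) ∸-suc ▸ under (P □) #0 ▸ ≐-sym (under (P □) (use (v0 ∷ v1 ∷ []) ∸-suc)))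

x+y∸y≐x : ⊢ ((v0 +T v1) -T v1) ≐ v0
x+y∸y≐x = induction 1 _ (use (v0 +T zeroT ∷ []) ∸-identityʳ ▸ use (v0 ∷ []) +-identityʳ)
  (under (□ -T S v1) (use (v0 ∷ v1 ∷ []) +-suc) ▸ use (v0 +T v1 ∷ v1 ∷ []) Sx∸Sy≐x∸y ▸ #0)

x∸[x+y]≐0 : ⊢ (v0 -T (v0 +T v1)) ≐ zeroT
x∸[x+y]≐0 = induction 1 _ (under (v0 -T □) (use (v0 ∷ []) +-identityʳ) ▸ use (v0 ∷ []) x∸x≐0)
  (under (v0 -T □) (use (v0 ∷ v1 ∷ []) +-suc) ▸ use (v0 ∷ v0 +T v1 ∷ []) ∸-suc ▸ under (P □) #0 ▸ thm P-0)

[x+z]∸[y+z]≐x∸y : ⊢ ((v0 +T v2) -T (v1 +T v2)) ≐ (v0 -T v1)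
[x+z]∸[y+z]≐x∸y = induction 2 _ (under (□ -T (v1 +T zeroT)) (use (v0 ∷ []) +-identityʳ) ▸ under (v0 -T □) (use (v1 ∷ []) +-identityʳ))
  (under (□ -T (v1 +T S v2)) (use (v0 ∷ v2 ∷ []) +-suc) ▸ under (S (v0 +T v2) -T □) (use (v1 ∷ v2 ∷ []) +-suc)
    ▸ use (v0 +T v2 ∷ v1 +T v2 ∷ []) Sx∸Sy≐x∸y ▸ #0)

x≐0∨x≐SPx : ⊢ (v0 ≐ zeroT) ∨' (v0 ≐ S (P v0))
x≐0∨x≐SPx = induction 0 _ (∨-inj₁ (wfF! (zeroT ≐ S (P zeroT))) (≐-refl (wf! zeroT)))
  (∨-inj₂ (wfF! (S v0 ≐ zeroT)) (under (S □) (≐-sym (use (zeroT ∷ v0 ∷ []) P-S))))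

x≤y⇒x+[y∸x]≐y : ⊢ (v0 ≤F v1) ⇒ ((v0 +T (v1 -T v0)) ≐ v1)
x≤y⇒x+[y∸x]≐y = induction 0 _ (⇒-intro (use (v1 -T zeroT ∷ []) +-identityˡ ▸ use (v1 ∷ []) ∸-identityʳ)) (⇒-intro step)
  where
    Γ : List Fm
    Γ = (S v0 ≤F v1) ∷ ((v0 ≤F v1) ⇒ ((v0 +T (v1 -T v0)) ≐ v1)) ∷ []
    x≤y : Γ ⊩ v0 ≤F v1
    x≤y = ≐-sym (under (□ -T v1) (use (zeroT ∷ v0 ∷ []) P-S)) ▸ use (S v0 ∷ v1 ∷ []) Px∸y≐P[x∸y] ▸ under (P □) #0 ▸ thm P-0
    ih : Γ ⊩ (v0 +T (v1 -T v0)) ≐ v1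
    ih = mp x≤y #1
    step : Γ ⊩ (S v0 +T (v1 -T S v0)) ≐ v1
    step = ∨-elim (use (v1 -T v0 ∷ []) x≐0∨x≐SPx)
      (let x≐y = ≐-sym (use (v0 ∷ []) +-identityʳ) ▸ ≐-sym (under (v0 +T □) #0) ▸ wk ih
       in absurd (≐-sym (use (v0 ∷ []) Sx∸x≐1) ▸ under (S v0 -T □) x≐y ▸ #1) (S≢0 wf-0))
      (under (S v0 +T □) (use (v1 ∷ v0 ∷ []) ∸-suc) ▸ use (v0 ∷ P (v1 -T v0) ∷ []) suc-+
        ▸ ≐-sym (use (v0 ∷ P (v1 -T v0) ∷ []) +-suc) ▸ ≐-sym (under (v0 +T □) #0) ▸ wk ih)

≤-antisym : ⊢ (v0 ≤F v1) ⇒ ((v1 ≤F v0) ⇒ (v0 ≐ v1))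
≤-antisym = closed (⇒-intro (⇒-intro
  (≐-sym (use (v0 ∷ []) +-identityʳ) ▸ ≐-sym (under (v0 +T □) #0) ▸ mp #1 (use (v0 ∷ v1 ∷ []) x≤y⇒x+[y∸x]≐y))))

x+y≐0⇒y≐0 : ⊢ ((v0 +T v1) ≐ zeroT) ⇒ (v1 ≐ zeroT)
x+y≐0⇒y≐0 = closed (⇒-intro (∨-elim (use (v1 ∷ []) x≐0∨x≐SPx) #0
  (absurd (≐-sym (use (v0 ∷ P v1 ∷ []) +-suc) ▸ ≐-sym (under (v0 +T □) #0) ▸ #1) (S≢0 (wf! (v0 +T P v1))))))

x+y≐0⇒x≐0 : ⊢ ((v0 +T v1) ≐ zeroT) ⇒ (v0 ≐ zeroT)
x+y≐0⇒x≐0 = closed (⇒-intro (≐-sym (use (v0 ∷ []) +-identityʳ) ▸ ≐-sym (under (v0 +T □) (mp #0 (use (v0 ∷ v1 ∷ []) x+y≐0⇒y≐0))) ▸ #0))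

≤-total : ⊢ (v0 ≤F v1) ∨' (v1 ≤F v0)
≤-total = induction 1 _ (∨-inj₂ (wfF! (v0 ≤F zeroT)) (use (v0 ∷ []) 0∸x≐0))
  (∨-elim #0
    (∨-inj₁ (wfF! (S v1 ≤F v0)) (use (v0 ∷ v1 ∷ []) ∸-suc ▸ under (P □) #0 ▸ thm P-0))
    (∨-elim (use (v0 -T v1 ∷ []) x≐0∨x≐SPx)
      (∨-inj₁ (wfF! (S v1 ≤F v0)) (use (v0 ∷ v1 ∷ []) ∸-suc ▸ under (P □) #0 ▸ thm P-0))
      (let k = P (v0 -T v1)
           y+[x∸y]≐x = mp #1 (use (v1 ∷ v0 ∷ []) x≤y⇒x+[y∸x]≐y)
           Sy+k≐x = use (v1 ∷ k ∷ []) suc-+ ▸ ≐-sym (use (v1 ∷ k ∷ []) +-suc) ▸ ≐-sym (under (v1 +T □) #0) ▸ y+[x∸y]≐x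
       in ∨-inj₂ (wfF! (v0 ≤F S v1)) (≐-sym (under (S v1 -T □) Sy+k≐x) ▸ use (S v1 ∷ k ∷ []) x∸[x+y]≐0))))

x≤0⇒x≐0 : ⊢ (v0 ≤F zeroT) ⇒ (v0 ≐ zeroT)
x≤0⇒x≐0 = closed (⇒-intro (≐-sym (use (v0 ∷ []) ∸-identityʳ) ▸ #0))

Sx≰x : ⊢ ¬' (S v0 ≤F v0)
Sx≰x = closed (¬-intro (wfF! (S v0 ≤F v0)) (absurd (≐-sym (use (v0 ∷ []) Sx∸x≐1) ▸ #0) (S≢0 (wf! zeroT))))

x≤y⇒x≤Sy : ⊢ (v0 ≤F v1) ⇒ (v0 ≤F S v1)
x≤y⇒x≤Sy = closed (⇒-intro (use (v0 ∷ v1 ∷ []) ∸-suc ▸ under (P □) #0 ▸ thm P-0))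

≤-trans⊢ : ⊢ (v0 ≤F v1) ⇒ ((v1 ≤F v2) ⇒ (v0 ≤F v2))
≤-trans⊢ = closed (⇒-intro (⇒-intro
  (let x+[y∸x]≐y = mp #1 (use (v0 ∷ v1 ∷ []) x≤y⇒x+[y∸x]≐y)
       y+[z∸y]≐z = mp #0 (use (v1 ∷ v2 ∷ []) x≤y⇒x+[y∸x]≐y)
       z≐x+[[y∸x]+[z∸y]] = ≐-sym y+[z∸y]≐z ▸ ≐-sym (under (□ +T (v2 -T v1)) x+[y∸x]≐y) ▸ use (v0 ∷ v1 -T v0 ∷ v2 -T v1 ∷ []) +-assoc
   in under (v0 -T □) z≐x+[[y∸x]+[z∸y]] ▸ use (v0 ∷ (v1 -T v0) +T (v2 -T v1) ∷ []) x∸[x+y]≐0)))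

+-monoˡ-≤ : ⊢ (v0 ≤F v1) ⇒ ((v0 +T v2) ≤F (v1 +T v2))
+-monoˡ-≤ = closed (⇒-intro (use (v0 ∷ v1 ∷ v2 ∷ []) [x+z]∸[y+z]≐x∸y ▸ #0))

x≤Sx : ⊢ v0 ≤F S v0
x≤Sx = closed (use (v0 ∷ v0 ∷ []) ∸-suc ▸ under (P □) (use (v0 ∷ []) x∸x≐0) ▸ thm P-0)

x≤Sy⇒x≤y∨x≐Sy : ⊢ (v0 ≤F S v1) ⇒ ((v0 ≤F v1) ∨' (v0 ≐ S v1))
x≤Sy⇒x≤y∨x≐Sy = closed (⇒-intro
  (let P[x∸y]≐0 = ≐-sym (use (v0 ∷ v1 ∷ []) ∸-suc) ▸ #0
   in ∨-elim (use (v0 -T v1 ∷ []) x≐0∨x≐SPx) (∨-inj₁ (wfF! (v0 ≐ S v1)) #0)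
       (let x∸y≐1 = #0 ▸ under (S □) (wk P[x∸y]≐0)
        in ∨-elim (use (v0 ∷ v1 ∷ []) ≤-total)
             (absurd (≐-sym (wk x∸y≐1) ▸ #0) (S≢0 (wf! zeroT)))
             (∨-inj₂ (wfF! (v0 ≤F v1)) (≐-sym (mp #0 (use (v1 ∷ v0 ∷ []) x≤y⇒x+[y∸x]≐y)) ▸ under (v1 +T □) (wk x∸y≐1)
                 ▸ use (v1 ∷ zeroT ∷ []) +-suc ▸ under (S □) (use (v1 ∷ []) +-identityʳ))))))

Sx+Sx≐SS[x+x] : ⊢ (S v0 +T S v0) ≐ S (S (v0 +T v0))
Sx+Sx≐SS[x+x] = closed (use (S v0 ∷ v0 ∷ []) +-suc ▸ under (S □) (use (v0 ∷ v0 ∷ []) suc-+))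

Parity-Half-double : ⊢ (Parity (v0 +T v0) ≐ zeroT) ∧' (Half (v0 +T v0) ≐ v0)
Parity-Half-double = induction 0 _
  (∧-intro (under (Parity □) (use (zeroT ∷ []) +-identityʳ) ▸ thm Parity-0) (under (Half □) (use (zeroT ∷ []) +-identityʳ) ▸ thm Half-0))
  (let Parity[x+x]≐0 = ∧-proj₁ #0
       Parity[S[x+x]]≐1 = use (v0 +T v0 ∷ []) Parity-S ▸ under (C □ 1T zeroT) Parity[x+x]≐0 ▸ use (1T ∷ zeroT ∷ []) C-0
       Half[S[x+x]]≐x = use (v0 +T v0 ∷ []) Half-S ▸ under (C □ (Half (v0 +T v0)) (S (Half (v0 +T v0)))) Parity[x+x]≐0
               ▸ use (Half (v0 +T v0) ∷ S (Half (v0 +T v0)) ∷ []) C-0 ▸ ∧-proj₂ #0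
   in ∧-intro (under (Parity □) (use (v0 ∷ []) Sx+Sx≐SS[x+x]) ▸ use (S (v0 +T v0) ∷ []) Parity-S ▸ under (C □ 1T zeroT) Parity[S[x+x]]≐1
             ▸ use (1T ∷ zeroT ∷ zeroT ∷ []) C-S)
           (under (Half □) (use (v0 ∷ []) Sx+Sx≐SS[x+x]) ▸ use (S (v0 +T v0) ∷ []) Half-S
             ▸ under (C □ (Half (S (v0 +T v0))) (S (Half (S (v0 +T v0))))) Parity[S[x+x]]≐1
             ▸ use (Half (S (v0 +T v0)) ∷ S (Half (S (v0 +T v0))) ∷ zeroT ∷ []) C-S ▸ under (S □) Half[S[x+x]]≐x))

Half-double : ⊢ Half (v0 +T v0) ≐ v0
Half-double = closed (∧-proj₂ (thm Parity-Half-double))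

Half-suc-double : ⊢ Half (S (v0 +T v0)) ≐ v0
Half-suc-double = closed (use (v0 +T v0 ∷ []) Half-S ▸ under (C □ (Half (v0 +T v0)) (S (Half (v0 +T v0)))) (∧-proj₁ (thm Parity-Half-double))
               ▸ use (Half (v0 +T v0) ∷ S (Half (v0 +T v0)) ∷ []) C-0 ▸ ∧-proj₂ (thm Parity-Half-double))

2*x≐x+x : ⊢ (2T ·T v0) ≐ (v0 +T v0)
2*x≐x+x = induction 0 _ (use (2T ∷ []) *-zeroʳ ▸ ≐-sym (use (zeroT ∷ []) +-identityʳ))
  (use (2T ∷ v0 ∷ []) *-suc ▸ under (2T +T □) #0 ▸ use (S zeroT ∷ v0 +T v0 ∷ []) suc-+
    ▸ under (S □) (use (zeroT ∷ v0 +T v0 ∷ []) suc-+) ▸ under (S (S □)) (use (v0 +T v0 ∷ []) +-identityˡ) ▸ ≐-sym (use (v0 ∷ []) Sx+Sx≐SS[x+x]))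

x≤y∨Sy≤x : ⊢ (v0 ≤F v1) ∨' (S v1 ≤F v0)
x≤y∨Sy≤x = closed (∨-elim (use (v0 ∷ v1 ∷ []) ≤-total) (∨-inj₁ (wfF! (S v1 ≤F v0)) #0)
  (∨-elim (use (v0 -T v1 ∷ []) x≐0∨x≐SPx) (∨-inj₁ (wfF! (S v1 ≤F v0)) #0)
    (let d = P (v0 -T v1)
         y+[x∸y]≐x = mp #1 (use (v1 ∷ v0 ∷ []) x≤y⇒x+[y∸x]≐y)
         Sy+d≐x = use (v1 ∷ d ∷ []) suc-+ ▸ ≐-sym (use (v1 ∷ d ∷ []) +-suc) ▸ ≐-sym (under (v1 +T □) #0) ▸ y+[x∸y]≐x
     in ∨-inj₂ (wfF! (v0 ≤F v1)) (≐-sym (under (S v1 -T □) Sy+d≐x) ▸ use (S v1 ∷ d ∷ []) x∸[x+y]≐0))))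

x<y⇒Sx≤y : ⊢ ((v0 ≤F v1) ∧' (¬' (v0 ≐ v1))) ⇒ (S v0 ≤F v1)
x<y⇒Sx≤y = closed (⇒-intro (∨-elim (use (v1 ∷ v0 ∷ []) x≤y∨Sy≤x)
  (absurd (mp #0 (mp (∧-proj₁ #1) (use (v0 ∷ v1 ∷ []) ≤-antisym))) (∧-proj₂ #1))
  #0))

x<x+Sy : ⊢ v0 <F (v0 +T S v1)
x<x+Sy = closed (∧-intro (use (v0 ∷ S v1 ∷ []) x∸[x+y]≐0)
  (¬-intro (wfF! (v0 ≐ (v0 +T S v1)))
    (absurd (≐-sym (use (S v1 ∷ v0 ∷ []) x+y∸y≐x) ▸ under (□ -T v0) (use (S v1 ∷ v0 ∷ []) +-comm)
              ▸ under (□ -T v0) (≐-sym #0) ▸ use (v0 ∷ []) x∸x≐0)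
         (S≢0 (wf! v1)))))

≤-respˡ-≐⊢ : ⊢ (v0 ≐ v1) ⇒ ((v0 ≤F v2) ⇒ (v1 ≤F v2))
≤-respˡ-≐⊢ = closed (⇒-intro (⇒-intro (≐-sym (under (□ -T v2) #1) ▸ #0)))

≤-respʳ-≐⊢ : ⊢ (v1 ≐ v2) ⇒ ((v0 ≤F v1) ⇒ (v0 ≤F v2))
≤-respʳ-≐⊢ = closed (⇒-intro (⇒-intro (≐-sym (under (v0 -T □) #1) ▸ #0)))

wf-≤ˡ : ∀ {s b} → WFFm (s ≤F b) → WFTm s
wf-≤ˡ (wf-eq (wf-app _ (wf-∷ ws _)) _) = ws
wf-≤ʳ : ∀ {s b} → WFFm (s ≤F b) → WFTm b
wf-≤ʳ (wf-eq (wf-app _ (wf-∷ _ (wf-∷ wb _))) _) = wb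

≤-respˡ-≐ : ∀ {Γ s s' b} → Γ ⊩ s ≐ s' → Γ ⊩ s ≤F b → Γ ⊩ s' ≤F b
≤-respˡ-≐ {s = s} {s'} {b} p q =
  mp q (mp p (use′ (s ∷ s' ∷ b ∷ []) (wf-lhs (⊩⇒wf p) ∷ wf-rhs (⊩⇒wf p) ∷ wf-≤ʳ (⊩⇒wf q) ∷ []) ≤-respˡ-≐⊢))

≤-respʳ-≐ : ∀ {Γ s b b'} → Γ ⊩ b ≐ b' → Γ ⊩ s ≤F b → Γ ⊩ s ≤F b'
≤-respʳ-≐ {s = s} {b} {b'} p q =
  mp q (mp p (use′ (s ∷ b ∷ b' ∷ []) (wf-≤ˡ (⊩⇒wf q) ∷ wf-lhs (⊩⇒wf p) ∷ wf-rhs (⊩⇒wf p) ∷ []) ≤-respʳ-≐⊢))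

≤-trans : ∀ {Γ a b c} → Γ ⊩ a ≤F b → Γ ⊩ b ≤F c → Γ ⊩ a ≤F c
≤-trans {a = a} {b} {c} p q =
  mp q (mp p (use′ (a ∷ b ∷ c ∷ []) (wf-≤ˡ (⊩⇒wf p) ∷ wf-≤ʳ (⊩⇒wf p) ∷ wf-≤ʳ (⊩⇒wf q) ∷ []) ≤-trans⊢))

Sx≤2^x : ⊢ S v0 ≤F (2T ↑T v0)
Sx≤2^x = induction 0 _ (under (S zeroT -T □) (use (2T ∷ []) ^-0) ▸ use (1T ∷ []) x∸x≐0)
  (≤-respˡ-≐ Sx+1≐SSx (≤-respʳ-≐ p+p≐2^Sx (≤-trans (mp #0 (use (S v0 ∷ p ∷ 1T ∷ []) +-monoˡ-≤)) p+1≤p+p)))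
  where
    p : Tm
    p = 2T ↑T v0
    Γ : List Fm
    Γ = (S v0 ≤F p) ∷ []
    Sx+1≐SSx : Γ ⊩ (S v0 +T 1T) ≐ S (S v0)
    Sx+1≐SSx = use (S v0 ∷ zeroT ∷ []) +-suc ▸ under (S □) (use (S v0 ∷ []) +-identityʳ)
    p+p≐2^Sx : Γ ⊩ (p +T p) ≐ (2T ↑T S v0)
    p+p≐2^Sx = ≐-sym (use (2T ∷ v0 ∷ []) ^-suc ▸ use (p ∷ []) 2*x≐x+x)
    1≤p : Γ ⊩ 1T ≤F p
    1≤p = ≤-trans (use (zeroT ∷ v0 ∷ []) Sx∸Sy≐x∸y ▸ use (v0 ∷ []) 0∸x≐0) #0
    p+1≤p+p : Γ ⊩ (p +T 1T) ≤F (p +T p)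
    p+1≤p+p = ≤-respˡ-≐ (use (1T ∷ p ∷ []) +-comm) (mp 1≤p (use (1T ∷ p ∷ p ∷ []) +-monoˡ-≤))

x≤y⇒x+x≤y+y : ⊢ (v0 ≤F v1) ⇒ ((v0 +T v0) ≤F (v1 +T v1))
x≤y⇒x+x≤y+y = closed (⇒-intro (≤-trans (mp #0 (use (v0 ∷ v1 ∷ v0 ∷ []) +-monoˡ-≤))
                           (≤-respˡ-≐ (use (v0 ∷ v1 ∷ []) +-comm) (mp #0 (use (v0 ∷ v1 ∷ v1 ∷ []) +-monoˡ-≤)))))

x+x≤S[y+y]⇒x≤y : ⊢ ((v0 +T v0) ≤F S (v1 +T v1)) ⇒ (v0 ≤F v1)
x+x≤S[y+y]⇒x≤y = closed (⇒-intro (∨-elim (use (v0 ∷ v1 ∷ []) x≤y∨Sy≤x) #0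
  (absurd (≤-trans (≤-respˡ-≐ (use (v1 ∷ []) Sx+Sx≐SS[x+x]) (mp #0 (use (S v1 ∷ v0 ∷ []) x≤y⇒x+x≤y+y))) #1)
          (use (S (v1 +T v1) ∷ []) Sx≰x))))

y≤x⇒Sx∸y≐S[x∸y] : ⊢ (v1 ≤F v0) ⇒ ((S v0 -T v1) ≐ S (v0 -T v1))
y≤x⇒Sx∸y≐S[x∸y] = closed (⇒-intro
  (let d = v0 -T v1
       y+[x∸y]≐x = mp #0 (use (v1 ∷ v0 ∷ []) x≤y⇒x+[y∸x]≐y)
   in under (S □ -T v1) (≐-sym y+[x∸y]≐x) ▸ under (□ -T v1) (≐-sym (use (v1 ∷ d ∷ []) +-suc))
      ▸ under (□ -T v1) (use (v1 ∷ S d ∷ []) +-comm) ▸ use (S d ∷ v1 ∷ []) x+y∸y≐x))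

[x+y]+[x+y]≐[y+y]+[x+x] : ⊢ ((v0 +T v1) +T (v0 +T v1)) ≐ ((v1 +T v1) +T (v0 +T v0))
[x+y]+[x+y]≐[y+y]+[x+x] = closed (use (v0 ∷ v1 ∷ v0 +T v1 ∷ []) +-assoc
  ▸ under (v0 +T □) (≐-sym (use (v1 ∷ v0 ∷ v1 ∷ []) +-assoc) ▸ under (□ +T v1) (use (v1 ∷ v0 ∷ []) +-comm)
                      ▸ use (v0 ∷ v1 ∷ v1 ∷ []) +-assoc)
  ▸ ≐-sym (use (v0 ∷ v0 ∷ v1 +T v1 ∷ []) +-assoc) ▸ use (v0 +T v0 ∷ v1 +T v1 ∷ []) +-comm)

x≤y⇒[y+y]∸[x+x]≐[y∸x]+[y∸x] : ⊢ (v0 ≤F v1) ⇒ (((v1 +T v1) -T (v0 +T v0)) ≐ ((v1 -T v0) +T (v1 -T v0)))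
x≤y⇒[y+y]∸[x+x]≐[y∸x]+[y∸x] = closed (⇒-intro
  (let d = v1 -T v0
       x+[y∸x]≐y = mp #0 (use (v0 ∷ v1 ∷ []) x≤y⇒x+[y∸x]≐y)
   in ≐-sym (under (□ -T (v0 +T v0)) (under (□ +T □) x+[y∸x]≐y))
      ▸ under (□ -T (v0 +T v0)) (use (v0 ∷ d ∷ []) [x+y]+[x+y]≐[y+y]+[x+x]) ▸ use (d +T d ∷ v0 +T v0 ∷ []) x+y∸y≐x))

x≤x+x : ⊢ v0 ≤F (v0 +T v0)
x≤x+x = closed (use (v0 ∷ v0 ∷ []) x∸[x+y]≐0)

-- Characteristic functions

vars-C : ∀ {p q r v} → v ∈ vars (C p q r) → v ∈ vars p ⊎ v ∈ vars q ⊎ v ∈ vars r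
vars-C {p} {q} {r} v∈ with ∈-++⁻ (vars q) v∈
... | inj₁ v∈q = inj₂ (inj₁ v∈q)
... | inj₂ v∈ with ∈-++⁻ (vars r) v∈
...   | inj₁ v∈r = inj₂ (inj₂ v∈r)
...   | inj₂ v∈ with ∈-++⁻ (vars p) v∈
...     | inj₁ v∈p = inj₁ v∈p

vars-app₂ : ∀ {f : Fn 2} {s t v} → v ∈ vars (app f (s ∷ t ∷ [])) → v ∈ vars s ⊎ v ∈ vars t
vars-app₂ {s = s} {t} v∈ with ∈-++⁻ (vars s) v∈
... | inj₁ v∈s = inj₁ v∈s
... | inj₂ v∈ with ∈-++⁻ (vars t) v∈
...   | inj₁ v∈t = inj₂ v∈t

vars-χ : ∀ B {v} → v ∈ vars (χ B) → v ∈ varsFm B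
vars-χ (s ≐ t) v∈ with vars-C {EqT s t} {zeroT} {1T} v∈
... | inj₁ v∈Eq with vars-app₂ {PlusF} {s -T t} {t -T s} v∈Eq
...   | inj₁ v∈s-t = [ ∈-++⁺ˡ , ∈-++⁺ʳ (vars s) ]′ (vars-app₂ {MinusF} {s} {t} v∈s-t)
...   | inj₂ v∈t-s = [ ∈-++⁺ʳ (vars s) , ∈-++⁺ˡ ]′ (vars-app₂ {MinusF} {t} {s} v∈t-s)
vars-χ (s ≐ t) v∈ | inj₂ (inj₁ ())
vars-χ (s ≐ t) v∈ | inj₂ (inj₂ ())
vars-χ (¬' B) v∈ with vars-C {χ B} {1T} {zeroT} v∈
... | inj₁ v∈B = vars-χ B v∈B
... | inj₂ (inj₁ ())
... | inj₂ (inj₂ ())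
vars-χ (A ∨' B) v∈ with vars-C {χ A} {zeroT} {C (χ B) zeroT 1T} v∈
... | inj₁ v∈A = ∈-++⁺ˡ (vars-χ A v∈A)
... | inj₂ (inj₂ v∈C) with vars-C {χ B} {zeroT} {1T} v∈C
...   | inj₁ v∈B = ∈-++⁺ʳ (varsFm A) (vars-χ B v∈B)
...   | inj₂ (inj₁ ())
...   | inj₂ (inj₂ ())
vars-χ (A ∨' B) v∈ | inj₂ (inj₁ ())

sub-χ : ∀ σ B → sub σ (χ B) ≡ χ (subF σ B)
sub-χ σ (s ≐ t) = refl
sub-χ σ (¬' B) = cong (λ k → C k 1T zeroT) (sub-χ σ B)
sub-χ σ (A ∨' B) = cong₂ (λ k l → C k zeroT (C l zeroT 1T)) (sub-χ σ A) (sub-χ σ B)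

wf-C : ∀ {a b c} → WFTm a → WFTm b → WFTm c → WFTm (C a b c)
wf-C wa wb wc = wf-app (wfFn! CF) (wf-∷ wb (wf-∷ wc (wf-∷ wa wf-[])))

wf-P : ∀ {a} → WFTm a → WFTm (P a)
wf-P wa = wf-app (wfFn! PredF) (wf-∷ wa wf-[])

wf-+ : ∀ {a b} → WFTm a → WFTm b → WFTm (a +T b)
wf-+ wa wb = wf-app (wfFn! PlusF) (wf-∷ wa (wf-∷ wb wf-[]))

wf-∸ : ∀ {a b} → WFTm a → WFTm b → WFTm (a -T b)
wf-∸ wa wb = wf-app (wfFn! MinusF) (wf-∷ wa (wf-∷ wb wf-[]))

wf-≤ : ∀ {a b} → WFTm a → WFTm b → WFFm (a ≤F b)
wf-≤ wa wb = wf-eq (wf-∸ wa wb) wf-0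

wf-χ : ∀ {A} → WFFm A → WFTm (χ A)
wf-χ (wf-eq ws wt) = wf-C (wf-+ (wf-∸ ws wt) (wf-∸ wt ws)) wf-0 (wf-S wf-0)
wf-χ (wf-neg wA) = wf-C (wf-χ wA) (wf-S wf-0) wf-0
wf-χ (wf-or wA wB) = wf-C (wf-χ wA) wf-0 (wf-C (wf-χ wB) wf-0 (wf-S wf-0))

wf-⇔ˡ : ∀ {A B} → WFFm (A ⇔ B) → WFFm A
wf-⇔ˡ (wf-neg (wf-or (wf-neg (wf-or (wf-neg wA) _)) _)) = wA

wf-⇔ʳ : ∀ {A B} → WFFm (A ⇔ B) → WFFm B
wf-⇔ʳ (wf-neg (wf-or (wf-neg (wf-or _ wB)) _)) = wB

⇔-trans : ∀ {A B C} → ⊢ A ⇔ B → ⊢ B ⇔ C → ⊢ A ⇔ C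
⇔-trans A⇔B B⇔C = closed (∧-intro
  (deduction wA (⇔-to (thm B⇔C) (⇔-to (thm A⇔B) (assumption wA))))
  (deduction wC (⇔-from (thm A⇔B) (⇔-from (thm B⇔C) (assumption wC)))))
  where
    wA = wf-⇔ˡ (⊢⇒wf A⇔B)
    wC = wf-⇔ʳ (⊢⇒wf B⇔C)

⇔-¬ : ∀ {A B} → ⊢ A ⇔ B → ⊢ (¬' A) ⇔ (¬' B)
⇔-¬ A⇔B = closed (∧-intro
  (deduction (wf-neg wA) (¬-intro wB (ex-falso (wf-neg wB) (⇔-from (thm A⇔B) (assumption wB)) (wk (assumption (wf-neg wA))))))
  (deduction (wf-neg wB) (¬-intro wA (ex-falso (wf-neg wA) (⇔-to (thm A⇔B) (assumption wA)) (wk (assumption (wf-neg wB)))))))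
  where
    wA = wf-⇔ˡ (⊢⇒wf A⇔B)
    wB = wf-⇔ʳ (⊢⇒wf A⇔B)

⇔-∨ : ∀ {A B A' B'} → ⊢ A ⇔ A' → ⊢ B ⇔ B' → ⊢ (A ∨' B) ⇔ (A' ∨' B')
⇔-∨ A⇔A' B⇔B' = closed (∧-intro
  (deduction (wf-or wA wB) (∨-elim (assumption (wf-or wA wB))
    (∨-inj₁ wB' (⇔-to (thm A⇔A') (assumption wA))) (∨-inj₂ wA' (⇔-to (thm B⇔B') (assumption wB)))))
  (deduction (wf-or wA' wB') (∨-elim (assumption (wf-or wA' wB'))
    (∨-inj₁ wB (⇔-from (thm A⇔A') (assumption wA'))) (∨-inj₂ wA (⇔-from (thm B⇔B') (assumption wB'))))))
  where
    wA = wf-⇔ˡ (⊢⇒wf A⇔A')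
    wA' = wf-⇔ʳ (⊢⇒wf A⇔A')
    wB = wf-⇔ˡ (⊢⇒wf B⇔B')
    wB' = wf-⇔ʳ (⊢⇒wf B⇔B')

Eq≐0⇔x≐y : ⊢ (EqT v0 v1 ≐ zeroT) ⇔ (v0 ≐ v1)
Eq≐0⇔x≐y = closed (∧-intro
  (⇒-intro (mp (mp #0 (use (v0 -T v1 ∷ v1 -T v0 ∷ []) x+y≐0⇒y≐0))
               (mp (mp #0 (use (v0 -T v1 ∷ v1 -T v0 ∷ []) x+y≐0⇒x≐0)) (use (v0 ∷ v1 ∷ []) ≤-antisym))))
  (⇒-intro (under (□ +T (v1 -T v0)) (under (□ -T v1) #0 ▸ use (v1 ∷ []) x∸x≐0)
        ▸ under (zeroT +T □) (under (v1 -T □) #0 ▸ use (v1 ∷ []) x∸x≐0) ▸ use (zeroT ∷ []) +-identityʳ)))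

C[x,0,1]≐0⇔x≐0 : ⊢ (C v0 zeroT 1T ≐ zeroT) ⇔ (v0 ≐ zeroT)
C[x,0,1]≐0⇔x≐0 = closed (∧-intro
  (⇒-intro (∨-elim (use (v0 ∷ []) x≐0∨x≐SPx) #0
     (absurd (≐-sym (use (zeroT ∷ 1T ∷ P v0 ∷ []) C-S) ▸ ≐-sym (under (C □ zeroT 1T) #0) ▸ #1) (S≢0 wf-0))))
  (⇒-intro (under (C □ zeroT 1T) #0 ▸ use (zeroT ∷ 1T ∷ []) C-0)))

C[x,1,0]≐0⇔¬x≐0 : ⊢ (C v0 1T zeroT ≐ zeroT) ⇔ (¬' (v0 ≐ zeroT))
C[x,1,0]≐0⇔¬x≐0 = closed (∧-intro
  (⇒-intro (¬-intro (wfF! (v0 ≐ zeroT))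
    (absurd (≐-sym (use (1T ∷ zeroT ∷ []) C-0) ▸ ≐-sym (under (C □ 1T zeroT) #0) ▸ #1) (S≢0 wf-0))))
  (⇒-intro (∨-elim (use (v0 ∷ []) x≐0∨x≐SPx) (absurd #0 #1)
     (under (C □ 1T zeroT) #0 ▸ use (1T ∷ zeroT ∷ P v0 ∷ []) C-S))))

C[x,0,C[y,0,1]]≐0⇔x≐0∨y≐0 : ⊢ (C v0 zeroT (C v1 zeroT 1T) ≐ zeroT) ⇔ ((v0 ≐ zeroT) ∨' (v1 ≐ zeroT))
C[x,0,C[y,0,1]]≐0⇔x≐0∨y≐0 = closed (∧-intro
  (⇒-intro (∨-elim (use (v0 ∷ []) x≐0∨x≐SPx) (∨-inj₁ (wfF! (v1 ≐ zeroT)) #0)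
     (∨-inj₂ (wfF! (v0 ≐ zeroT)) (⇔-to (use (v1 ∷ []) C[x,0,1]≐0⇔x≐0)
        (≐-sym (use (zeroT ∷ C v1 zeroT 1T ∷ P v0 ∷ []) C-S) ▸ ≐-sym (under (C □ zeroT (C v1 zeroT 1T)) #0) ▸ #1)))))
  (⇒-intro (∨-elim #0 (under (C □ zeroT (C v1 zeroT 1T)) #0 ▸ use (zeroT ∷ C v1 zeroT 1T ∷ []) C-0)
     (∨-elim (use (v0 ∷ []) x≐0∨x≐SPx) (under (C □ zeroT (C v1 zeroT 1T)) #0 ▸ use (zeroT ∷ C v1 zeroT 1T ∷ []) C-0)
        (under (C □ zeroT (C v1 zeroT 1T)) #0 ▸ use (zeroT ∷ C v1 zeroT 1T ∷ P v0 ∷ []) C-S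
          ▸ under (C □ zeroT 1T) #1 ▸ use (zeroT ∷ 1T ∷ []) C-0)))))

χ-correct : ∀ A → WFFm A → ⊢ (χ A ≐ zeroT) ⇔ A
χ-correct (s ≐ t) (wf-eq ws wt) =
  ⇔-trans (⊢-⟪⟫ (EqT s t ∷ []) (wf-+ (wf-∸ ws wt) (wf-∸ wt ws) ∷ []) C[x,0,1]≐0⇔x≐0)
          (⊢-⟪⟫ (s ∷ t ∷ []) (ws ∷ wt ∷ []) Eq≐0⇔x≐y)
χ-correct (¬' A) (wf-neg wA) =
  ⇔-trans (⊢-⟪⟫ (χ A ∷ []) (wf-χ wA ∷ []) C[x,1,0]≐0⇔¬x≐0) (⇔-¬ (χ-correct A wA))
χ-correct (A ∨' B) (wf-or wA wB) =
  ⇔-trans (⊢-⟪⟫ (χ A ∷ χ B ∷ []) (wf-χ wA ∷ wf-χ wB ∷ []) C[x,0,C[y,0,1]]≐0⇔x≐0∨y≐0) (⇔-∨ (χ-correct A wA) (χ-correct B wB))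

C-cong : ∀ {Γ k k' a c} → WFTm a → WFTm c → Γ ⊩ k ≐ k' → Γ ⊩ C k a c ≐ C k' a c
C-cong {k = k} {k'} {a} {c} wa wc k≐k' with ⊩⇒wf k≐k'
... | wf-eq wk wk' = mp k≐k' (use′ (k ∷ k' ∷ a ∷ c ∷ []) (wk ∷ wk' ∷ wa ∷ wc ∷ []) C-cong⊢)
  where
    C-cong⊢ : ⊢ (v0 ≐ v1) ⇒ (C v0 v2 v3 ≐ C v1 v2 v3)
    C-cong⊢ = closed (⇒-intro (under (C □ v2 v3) #0))

C-χ-true : ∀ {Γ B a c} → WFTm a → WFTm c → Γ ⊩ B → Γ ⊩ C (χ B) a c ≐ a
C-χ-true {B = B} {a} {c} wa wc p = C-cong wa wc (⇔-from (thm (χ-correct B (⊩⇒wf p))) p) ▸ use′ (a ∷ c ∷ []) (wa ∷ wc ∷ []) C-0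

C-χ-false : ∀ {Γ B a c} → WFTm a → WFTm c → Γ ⊩ ¬' B → Γ ⊩ C (χ B) a c ≐ c
C-χ-false {B = B} {a} {c} wa wc ¬p = C-cong wa wc χB≐SPχB ▸ use′ (a ∷ c ∷ P (χ B) ∷ []) (wa ∷ wc ∷ wf-P wχB ∷ []) C-S
  where
    wB = wf-¬ (⊩⇒wf ¬p)
    wχB = wf-χ wB
    χB≐SPχB = ∨-elim (use′ (χ B ∷ []) (wχB ∷ []) x≐0∨x≐SPx)
      (ex-falso (wf-eq wχB (wf-S (wf-P wχB))) (⇔-to (thm (χ-correct B wB)) (assumption (wf-eq wχB wf-0))) (wk ¬p))
      (assumption (wf-eq wχB (wf-S (wf-P wχB))))

-- Primitive recursion and bounded minimisation

⊢-rec-suc : ∀ {n} {xs : Vec Var n} {y z a b t} → WFFn (rec xs y z a b) → WFTm t →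
            ⊢ appRec (rec xs y z a b) xs (S t) ≐ sub (update (y ↦ t) z (appRec (rec xs y z a b) xs t)) b
⊢-rec-suc {n} {xs} {y} {z} {a} {b} {t} wf@(wf-rec distinct _ _ _ _) wt =
  ⊢-≡ (cong₂ _≐_ (trans (recursive-call (S (var y))) (cong (appRec F xs ∘ S) (update-same var y t))) step) (⊢-↦ y t wt (ax-defS wf))
  where
    F : Fn (suc n)
    F = rec xs y z a b
    recursive-call : ∀ r → sub (y ↦ t) (appRec F xs r) ≡ appRec F xs (sub (y ↦ t) r)
    recursive-call r = sub-appRec (y ↦ t) F xs r λ v∈xs → update-other var t λ { refl → Unique-∉₀ distinct v∈xs refl }
    step : sub (y ↦ t) (substT z (appRec F xs (var y)) b) ≡ sub (update (y ↦ t) z (appRec F xs t)) b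
    step = trans (cong (sub (y ↦ t)) (substT-↦ z _ b)) (trans (sub-∘ (y ↦ t) (z ↦ _) b) (sub-agree b pointwise))
      where
        pointwise : ∀ {w} → w ∈ vars b → ((y ↦ t) ∘ₛ (z ↦ appRec F xs (var y))) w ≡ update (y ↦ t) z (appRec F xs t) w
        pointwise {w} _ with w ≟ z
        ... | yes _ = trans (recursive-call (var y)) (cong (appRec F xs) (update-same var y t))
        ... | no _ = refl

appRec-cong : ∀ {Γ n} {xs : Vec Var n} {y z a b s t} → WFFn (rec xs y z a b) → Γ ⊩ s ≐ t →
              Γ ⊩ appRec (rec xs y z a b) xs s ≐ appRec (rec xs y z a b) xs t
appRec-cong {Γ} {n} {xs} {y} {z} {a} {b} {s} {t} wf s≐t =
  subst₂ (λ l r → Γ ⊩ l ≐ r) (plug s) (plug t) (≐-cong (appRec F xs (var h)) h (wf-appRec wf (wf-var h)) s≐t)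
  where
    F : Fn (suc n)
    F = rec xs y z a b
    h : Var
    h = fresh (toList xs)
    plug : ∀ r → substT h r (appRec F xs (var h)) ≡ appRec F xs r
    plug r = trans (substT-↦ h r (appRec F xs (var h)))
      (trans (sub-appRec (h ↦ r) F xs (var h) λ v∈xs → update-other var r λ { refl → fresh-∉ (toList xs) v∈xs })
             (cong (appRec F xs) (update-same var h r)))

module Minimisation (A : Fm) (x : Var) (wA : WFFm A) where

  private
    ys : List Var
    ys = otherVars A x
    z : Var
    z = freshVar A x
    keep-other : (v : Var) → Dec (v ≢ x)
    keep-other v = ¬? (v ≟ x)

  ∈-others⁻ : ∀ {v} → v ∈ ys → v ∈ varsFm A × v ≢ x
  ∈-others⁻ v∈ys = ∈-filter⁻ keep-other (∈-deduplicate⁻ _≟_ (filter keep-other (varsFm A)) v∈ys)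

  ∈-others⁺ : ∀ {v} → v ∈ varsFm A → v ≢ x → v ∈ ys
  ∈-others⁺ v∈A v≢x = ∈-deduplicate⁺ _≟_ (∈-filter⁺ keep-other v∈A v≢x)

  fresh-∉A : ∀ {v} → v ∈ varsFm A → v ≢ z
  fresh-∉A v∈A refl = <-irrefl refl (∈⇒≤foldr-⊔ x v∈A)

  x≢fresh : x ≢ z
  x≢fresh x≡z = <-irrefl x≡z (s≤s (seed≤foldr-⊔ x (varsFm A)))

  m : Tm → Tm
  m t = μ A x t

  A⟨_⟩ : Tm → Fm
  A⟨ t ⟩ = substF x t A

  wf-A : ∀ {t} → WFTm t → WFFm A⟨ t ⟩
  wf-A wt = wf-substF wt wA

  wf-MuF : WFFn (MuF A x)
  wf-MuF = wf-rec distinct base-vars step-vars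
    (wf-C (wf-χ (wf-A wf-0)) wf-0 (wf-S wf-0))
    (wf-C (wf-χ (wf-≤ (wf-var z) (wf-var x))) (wf-var z) (wf-C (wf-χ (wf-A (wf-S (wf-var x)))) (wf-S (wf-var x)) (wf-S (wf-S (wf-var x)))))
    where
      distinct : Unique (x ∷ z ∷ toList (fromList ys))
      distinct rewrite toList∘fromList ys =
        All.tabulate (λ { (here refl) → x≢fresh ; (there v∈ys) x≡v → proj₂ (∈-others⁻ v∈ys) (sym x≡v) })
        ∷ All.tabulate (λ v∈ys z≡v → fresh-∉A (proj₁ (∈-others⁻ v∈ys)) (sym z≡v))
        ∷ deduplicate-! _
      base-vars : All (_∈ toList (fromList ys)) (vars (C (χ A⟨ zeroT ⟩) zeroT 1T))
      base-vars rewrite toList∘fromList ys = All.tabulate λ v∈ → case-base (vars-C {χ A⟨ zeroT ⟩} {zeroT} {1T} v∈)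
        where
          case-base : ∀ {v} → v ∈ vars (χ A⟨ zeroT ⟩) ⊎ v ∈ [] ⊎ v ∈ [] → v ∈ ys
          case-base (inj₁ v∈χ) with vars-substF x zeroT A (vars-χ A⟨ zeroT ⟩ v∈χ)
          ... | inj₂ (v∈A , v≢x) = ∈-others⁺ v∈A v≢x
          case-base (inj₂ (inj₁ ()))
          case-base (inj₂ (inj₂ ()))
      step-vars : All (_∈ (x ∷ z ∷ toList (fromList ys)))
                      (vars (C (χ (var z ≤F var x)) (var z) (C (χ A⟨ S (var x) ⟩) (S (var x)) (S (S (var x))))))
      step-vars rewrite toList∘fromList ys =
        All.tabulate λ v∈ → case-step (vars-C {χ (var z ≤F var x)} {var z} {C (χ A⟨ S (var x) ⟩) (S (var x)) (S (S (var x)))} v∈)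
        where
          case-A : ∀ {v} → v ∈ vars (χ A⟨ S (var x) ⟩) → v ∈ (x ∷ z ∷ ys)
          case-A v∈χ with vars-substF x (S (var x)) A (vars-χ A⟨ S (var x) ⟩ v∈χ)
          ... | inj₁ (here refl) = here refl
          ... | inj₂ (v∈A , v≢x) = there (there (∈-others⁺ v∈A v≢x))
          case-step : ∀ {v} → v ∈ vars (χ (var z ≤F var x)) ⊎ v ∈ [ z ] ⊎ v ∈ vars (C (χ A⟨ S (var x) ⟩) (S (var x)) (S (S (var x))))
                    → v ∈ (x ∷ z ∷ ys)
          case-step (inj₁ v∈χ) with vars-χ (var z ≤F var x) v∈χ
          ... | here refl = there (here refl)
          ... | there (here refl) = here refl
          case-step (inj₂ (inj₁ (here refl))) = there (here refl)
          case-step (inj₂ (inj₂ v∈C)) with vars-C {χ A⟨ S (var x) ⟩} {S (var x)} {S (S (var x))} v∈C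
          ... | inj₁ v∈χ = case-A v∈χ
          ... | inj₂ (inj₁ (here refl)) = here refl
          ... | inj₂ (inj₂ (here refl)) = here refl

  wf-m : ∀ {t} → WFTm t → WFTm (m t)
  wf-m = wf-appRec wf-MuF

  FixesOthers : Subst → Set
  FixesOthers σ = ∀ {v} → v ∈ varsFm A → v ≢ x → σ v ≡ var v

  sub-m : ∀ σ t → FixesOthers σ → sub σ (m t) ≡ m (sub σ t)
  sub-m σ t fixes = sub-appRec σ (MuF A x) (fromList ys) t λ v∈ys →
    let v∈A , v≢x = ∈-others⁻ (subst (_ ∈_) (toList∘fromList ys) v∈ys) in fixes v∈A v≢x

  subF-A⟨⟩ : ∀ σ t → FixesOthers σ → subF σ A⟨ t ⟩ ≡ A⟨ sub σ t ⟩
  subF-A⟨⟩ σ t = subF-substF σ x t A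

  μ-zero : ⊢ m zeroT ≐ C (χ A⟨ zeroT ⟩) zeroT 1T
  μ-zero = ax-def0 wf-MuF

  μ-suc : ∀ b → WFTm b → ⊢ m (S b) ≐ C (χ (m b ≤F b)) (m b) (C (χ A⟨ S b ⟩) (S b) (S (S b)))
  μ-suc b wb = ⊢-≡ (cong (m (S b) ≐_) step-at-b) (⊢-rec-suc wf-MuF wb)
    where
      σ = update (x ↦ b) z (m b)
      σz : σ z ≡ m b
      σz = update-same (x ↦ b) z (m b)
      σx : σ x ≡ b
      σx = trans (update-other (x ↦ b) (m b) x≢fresh) (update-same var x b)
      σ-fixes : FixesOthers σ
      σ-fixes v∈A v≢x = trans (update-other (x ↦ b) (m b) (fresh-∉A v∈A)) (update-other var b v≢x)
      step-at-b : sub σ (C (χ (var z ≤F var x)) (var z) (C (χ A⟨ S (var x) ⟩) (S (var x)) (S (S (var x)))))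
                ≡ C (χ (m b ≤F b)) (m b) (C (χ A⟨ S b ⟩) (S b) (S (S b)))
      step-at-b =
        trans (cong₂ (λ k l → C k (σ z) (C l (S (σ x)) (S (S (σ x)))))
                     (sub-χ σ (var z ≤F var x)) (trans (sub-χ σ A⟨ S (var x) ⟩) (cong χ (subF-A⟨⟩ σ (S (var x)) σ-fixes))))
              (cong₂ (λ k l → C (χ (k ≤F l)) k (C (χ A⟨ S l ⟩) (S l) (S (S l)))) σz σx)

  -- x is free in the second conjunct, so it speaks about every witness x.
  Invariant : Tm → Fm
  Invariant t = ((m t ≤F t) ⇒ A⟨ m t ⟩) ∧' ((A ∧' (var x ≤F t)) ⇒ (m t ≤F t))

  wf-Invariant : ∀ {t} → WFTm t → WFFm (Invariant t)
  wf-Invariant wt = wf-∧ (wf-⇒ (wf-≤ (wf-m wt) wt) (wf-A (wf-m wt))) (wf-⇒ (wf-∧ wA (wf-≤ (wf-var x) wt)) (wf-≤ (wf-m wt) wt))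

  A⟨x⟩≡A : A⟨ var x ⟩ ≡ A
  A⟨x⟩≡A = trans (substF-↦ x (var x) A) (subF-fixes (x ↦ var x) A λ {v} _ → fixes v)
    where
      fixes : ∀ v → (x ↦ var x) v ≡ var v
      fixes v with v ≟ x
      ... | yes refl = refl
      ... | no _ = refl

  ⊩-A⟨x⟩ : ∀ {Γ} → Γ ⊩ A → Γ ⊩ A⟨ var x ⟩
  ⊩-A⟨x⟩ {Γ} = subst (Γ ⊩_) (sym A⟨x⟩≡A)

  invariant-zero : ⊢ Invariant zeroT
  invariant-zero = closed (∧-intro witness least)
    where
      m0≐ : ∀ {Γ} → Γ ⊩ m zeroT ≐ C (χ A⟨ zeroT ⟩) zeroT 1T
      m0≐ = thm μ-zero
      wm0 = wf-m wf-0
      witness : [] ⊩ (m zeroT ≤F zeroT) ⇒ A⟨ m zeroT ⟩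
      witness = deduction (wf-≤ wm0 wf-0) (by-cases (wf-A wf-0)
        (≐-subst x A wA (≐-sym (m0≐ ▸ C-χ-true wf-0 (wf-S wf-0) (assumption (wf-A wf-0)))) (assumption (wf-A wf-0)))
        (ex-falso (wf-A wm0)
           (mp (≤-respˡ-≐ (m0≐ ▸ C-χ-false wf-0 (wf-S wf-0) (assumption (wf-neg (wf-A wf-0)))) (wk (assumption (wf-≤ wm0 wf-0))))
               (use (1T ∷ []) x≤0⇒x≐0))
           (S≢0 wf-0)))
      hyp-wf = wf-∧ wA (wf-≤ (wf-var x) wf-0)
      least : [] ⊩ (A ∧' (var x ≤F zeroT)) ⇒ (m zeroT ≤F zeroT)
      least = deduction hyp-wf
        (let x≐0 = mp (∧-proj₂ (assumption hyp-wf)) (use′ (var x ∷ []) (wf-var x ∷ []) x≤0⇒x≐0)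
             A⟨0⟩ = ≐-subst x A wA x≐0 (⊩-A⟨x⟩ (∧-proj₁ (assumption hyp-wf)))
         in ≤-respˡ-≐ (≐-sym (m0≐ ▸ C-χ-true wf-0 (wf-S wf-0) A⟨0⟩)) (use (zeroT ∷ []) x∸x≐0))

  module _ (b : Tm) (wb : WFTm b) where
    private
      wSb : WFTm (S b)
      wSb = wf-S wb
      wmb : WFTm (m b)
      wmb = wf-m wb
      wmSb : WFTm (m (S b))
      wmSb = wf-m wSb
      m≤-wf : WFFm (m b ≤F b)
      m≤-wf = wf-≤ wmb wb
      witness-wf : WFFm (m (S b) ≤F S b)
      witness-wf = wf-≤ wmSb wSb
      least-wf : WFFm (A ∧' (var x ≤F S b))
      least-wf = wf-∧ wA (wf-≤ (wf-var x) wSb)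
      mSb≐ : ∀ {Γ} → Γ ⊩ m (S b) ≐ C (χ (m b ≤F b)) (m b) (C (χ A⟨ S b ⟩) (S b) (S (S b)))
      mSb≐ = thm (μ-suc b wb)
      wf-inner : WFTm (C (χ A⟨ S b ⟩) (S b) (S (S b)))
      wf-inner = wf-C (wf-χ (wf-A wSb)) wSb (wf-S wSb)

    invariant-suc-found : ((m b ≤F b) ∷ Invariant b ∷ []) ⊩ Invariant (S b)
    invariant-suc-found = ∧-intro
      (deduction witness-wf (≐-subst x A wA (≐-sym (wk mSb≐m)) (mp (wk (assumption m≤-wf)) (∧-proj₁ (wk (wk (assumption (wf-Invariant wb))))))))
      (deduction least-wf (≤-respˡ-≐ (≐-sym (wk mSb≐m)) (mp (wk (assumption m≤-wf)) (use′ (m b ∷ b ∷ []) (wmb ∷ wb ∷ []) x≤y⇒x≤Sy))))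
      where
        mSb≐m : ((m b ≤F b) ∷ Invariant b ∷ []) ⊩ m (S b) ≐ m b
        mSb≐m = mSb≐ ▸ C-χ-true wmb wf-inner (assumption m≤-wf)

    invariant-suc-new : ((¬' (m b ≤F b)) ∷ Invariant b ∷ []) ⊩ Invariant (S b)
    invariant-suc-new = by-cases (wf-A wSb)
      (∧-intro (deduction witness-wf (≐-subst x A wA (≐-sym (wk mSb≐Sb)) (wk (assumption (wf-A wSb)))))
               (deduction least-wf (≤-respˡ-≐ (≐-sym (wk mSb≐Sb)) (use′ (S b ∷ []) (wSb ∷ []) x∸x≐0))))
      (∧-intro (deduction witness-wf (ex-falso (wf-A wmSb) (≤-respˡ-≐ (wk mSb≐SSb) (assumption witness-wf)) (use′ (S b ∷ []) (wSb ∷ []) Sx≰x)))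
               (deduction least-wf (∨-elim (mp (∧-proj₂ (assumption least-wf)) (use′ (var x ∷ b ∷ []) (wf-var x ∷ wb ∷ []) x≤Sy⇒x≤y∨x≐Sy))
                 (ex-falso witness-wf
                   (mp (∧-intro (∧-proj₁ (wk (assumption least-wf))) (assumption (wf-≤ (wf-var x) wb)))
                       (∧-proj₂ (wk (wk (wk (wk (assumption (wf-Invariant wb))))))))
                   (wk (wk (wk (assumption (wf-neg m≤-wf))))))
                 (ex-falso witness-wf
                   (≐-subst x A wA (assumption (wf-eq (wf-var x) wSb)) (⊩-A⟨x⟩ (∧-proj₁ (wk (assumption least-wf)))))
                   (wk (wk (assumption (wf-neg (wf-A wSb)))))))))
      where
        Γ = (¬' (m b ≤F b)) ∷ Invariant b ∷ []
        mSb≐inner : Γ ⊩ m (S b) ≐ C (χ A⟨ S b ⟩) (S b) (S (S b))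
        mSb≐inner = mSb≐ ▸ C-χ-false wmb wf-inner (assumption (wf-neg m≤-wf))
        mSb≐Sb : (A⟨ S b ⟩ ∷ Γ) ⊩ m (S b) ≐ S b
        mSb≐Sb = wk mSb≐inner ▸ C-χ-true wSb (wf-S wSb) (assumption (wf-A wSb))
        mSb≐SSb : ((¬' A⟨ S b ⟩) ∷ Γ) ⊩ m (S b) ≐ S (S b)
        mSb≐SSb = wk mSb≐inner ▸ C-χ-false wSb (wf-S wSb) (assumption (wf-neg (wf-A wSb)))

    invariant-suc : ⊢ Invariant b ⇒ Invariant (S b)
    invariant-suc = closed (deduction (wf-Invariant wb) (by-cases m≤-wf invariant-suc-found invariant-suc-new))

  private
    i : Var
    i = fresh (x ∷ varsFm A)

    x≢i : x ≢ i
    x≢i x≡i = fresh-∉ (x ∷ varsFm A) (here (sym x≡i))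

    A∌i : ∀ {v} → v ∈ varsFm A → v ≢ i
    A∌i v∈A refl = fresh-∉ (x ∷ varsFm A) (there v∈A)

    Invariant-at : ∀ s → substF i s (Invariant (var i)) ≡ Invariant s
    Invariant-at s = trans (substF-↦ i s (Invariant (var i)))
      (cong₂ _∧'_ (cong₂ _⇒_ m≤ (trans (subF-A⟨⟩ σ (m (var i)) (λ v∈A _ → fixes-A v∈A)) (cong A⟨_⟩ σm)))
                  (cong₂ _⇒_ (cong₂ _∧'_ (subF-fixes σ A fixes-A) (cong₂ _≤F_ (update-other var s x≢i) σi)) m≤))
      where
        σ = i ↦ s
        fixes-A : ∀ {v} → v ∈ varsFm A → σ v ≡ var v
        fixes-A v∈A = update-other var s (A∌i v∈A)
        σi : σ i ≡ s
        σi = update-same var i s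
        σm : sub σ (m (var i)) ≡ m s
        σm = trans (sub-m σ (var i) (λ v∈A _ → fixes-A v∈A)) (cong m σi)
        m≤ : subF σ (m (var i) ≤F var i) ≡ (m s ≤F s)
        m≤ = cong₂ _≤F_ σm σi

    invariant : ⊢ Invariant (var i)
    invariant = r-ind i (⊢-≡ (sym (Invariant-at zeroT)) invariant-zero)
                        (⊢-≡ (cong (Invariant (var i) ⇒_) (sym (Invariant-at (S (var i))))) (invariant-suc (var i) (wf-var i)))

  μ-witness : ∀ b → WFTm b → ⊢ (m b ≤F b) ⇒ A⟨ m b ⟩
  μ-witness b wb = closed (∧-proj₁ (thm (⊢-≡ (Invariant-at b) (r-inst i b wb invariant))))

  μ-least : ∀ t b → WFTm t → WFTm b → ⊢ (A⟨ t ⟩ ∧' (t ≤F b)) ⇒ (m b ≤F b)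
  μ-least t b wt wb = ⊢-≡ instance-eq (⊢-sub σ (wf-update (wf-↦ wb) wt) (closed (∧-proj₂ (thm invariant))))
    where
      σ = update (i ↦ b) x t
      σx : σ x ≡ t
      σx = update-same (i ↦ b) x t
      σi : σ i ≡ b
      σi = trans (update-other (i ↦ b) t (x≢i ∘ sym)) (update-same var i b)
      fixes-A∖x : FixesOthers σ
      fixes-A∖x v∈A v≢x = trans (update-other (i ↦ b) t v≢x) (update-other var b (A∌i v∈A))
      σA : subF σ A ≡ A⟨ t ⟩
      σA = trans (cong (subF σ) (sym A⟨x⟩≡A)) (trans (subF-A⟨⟩ σ (var x) fixes-A∖x) (cong A⟨_⟩ σx))
      σm : sub σ (m (var i)) ≡ m b
      σm = trans (sub-m σ (var i) fixes-A∖x) (cong m σi)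
      instance-eq : subF σ ((A ∧' (var x ≤F var i)) ⇒ (m (var i) ≤F var i)) ≡ ((A⟨ t ⟩ ∧' (t ≤F b)) ⇒ (m b ≤F b))
      instance-eq = cong₂ _⇒_ (cong₂ _∧'_ σA (cong₂ _≤F_ σx σi)) (cong₂ _≤F_ σm σi)

-- Powers of two and concatenation

2^u≐q : Fm
2^u≐q = (2T ↑T var vu) ≐ var vq

module Log₂ = Minimisation 2^u≐q vu (wfF! 2^u≐q)
module Qμ = Minimisation BQ vq (wfF! BQ)

log₂ : Tm → Tm
log₂ q = substT vq q (μ 2^u≐q vu (var vq))

IsPowerOfTwo : Tm → Fm
IsPowerOfTwo q = substF vq q (PowerOfTwo (var vq))

Q-spec : Tm → Tm → Fm
Q-spec s q = IsPowerOfTwo q ∧' ((q ≤F S s) ∧' (S s <F (2T ·T q)))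

pow2-intro : ∀ {Γ u q} → Γ ⊩ (2T ↑T u) ≐ q → Γ ⊩ u ≤F q → Γ ⊩ IsPowerOfTwo q
pow2-intro {u = u} {q} 2^u≐q u≤q =
  mp (mp (∧-intro 2^u≐q u≤q)
         (use′ (v0 ∷ q ∷ v2 ∷ u ∷ []) (wf-var 0 ∷ wq ∷ wf-var 2 ∷ wu ∷ []) (Log₂.μ-least (var 3) (var 1) (wf-var 3) (wf-var 1))))
     (use′ (v0 ∷ q ∷ []) (wf-var 0 ∷ wq ∷ []) (Log₂.μ-witness (var 1) (wf-var 1)))
  where
    wu = wf-≤ˡ (⊩⇒wf u≤q)
    wq = wf-≤ʳ (⊩⇒wf u≤q)

Q-spec-μ : ∀ {Γ s q} → WFTm s → Γ ⊩ Q-spec s q → Γ ⊩ q ≤F S s → Γ ⊩ Q-spec s (Q s)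
Q-spec-μ {s = s} {q} ws spec q≤Ss =
  mp (mp (∧-intro spec q≤Ss) (use′ (s ∷ v1 ∷ q ∷ []) (ws ∷ wf-var 1 ∷ wq ∷ []) (Qμ.μ-least (var 2) (S v0) (wf-var 2) (wf-S (wf-var 0)))))
     (use′ (s ∷ []) (ws ∷ []) (Qμ.μ-witness (S v0) (wf-S (wf-var 0))))
  where
    wq = wf-≤ˡ (⊩⇒wf q≤Ss)

pow2-1 : ⊢ IsPowerOfTwo 1T
pow2-1 = closed (pow2-intro (use (2T ∷ []) ^-0) (use (1T ∷ []) 0∸x≐0))

pow2-double : ∀ {Γ q} → Γ ⊩ IsPowerOfTwo q → Γ ⊩ IsPowerOfTwo (2T ·T q)
pow2-double {q = q} pow2 = pow2-intro (use′ (2T ∷ k ∷ []) (wf! 2T ∷ wlog ∷ []) ^-suc ▸ ≐-cong (2T ·T var 0) 0 (wf! (2T ·T var 0)) pow2)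
  (≤-trans (≤-respʳ-≐ pow2 (use′ (k ∷ []) (wlog ∷ []) Sx≤2^x)) (≤-respʳ-≐ (≐-sym (use′ (q ∷ []) (wq ∷ []) 2*x≐x+x)) (use′ (q ∷ []) (wq ∷ []) x≤x+x)))
  where
    wq = wf-rhs (⊩⇒wf pow2)
    k = log₂ q
    wlog = wf-substT {vq} wq (Log₂.wf-m (wf-var vq))

<-resp-≐ : ∀ {Γ a a' b b'} → Γ ⊩ a ≐ a' → Γ ⊩ b ≐ b' → Γ ⊩ a <F b → Γ ⊩ a' <F b'
<-resp-≐ {a = a} {a'} {b} {b'} a≐a' b≐b' a<b with ⊩⇒wf a≐a' | ⊩⇒wf b≐b'
... | wf-eq wa wa' | wf-eq wb wb' = mp a<b (mp b≐b' (mp a≐a' (use′ (a ∷ a' ∷ b ∷ b' ∷ []) (wa ∷ wa' ∷ wb ∷ wb' ∷ []) <-resp-≐⊢)))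
  where
    <-resp-≐⊢ : ⊢ (v0 ≐ v1) ⇒ ((v2 ≐ v3) ⇒ ((v0 <F v2) ⇒ (v1 <F v3)))
    <-resp-≐⊢ = closed (⇒-intro (⇒-intro (⇒-intro (∧-intro (≤-respʳ-≐ #1 (≤-respˡ-≐ #2 (∧-proj₁ #0)))
      (¬-intro (wfF! (v1 ≐ v3)) (absurd (#3 ▸ #0 ▸ ≐-sym #2) (∧-proj₂ #1)))))))

1+1≐2 : ∀ {Γ} → Γ ⊩ (1T +T 1T) ≐ 2T
1+1≐2 = use (1T ∷ zeroT ∷ []) +-suc ▸ under (S □) (use (1T ∷ []) +-identityʳ)

2*1≐2 : ∀ {Γ} → Γ ⊩ (2T ·T 1T) ≐ 2T
2*1≐2 = use (1T ∷ []) 2*x≐x+x ▸ 1+1≐2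

-- Q (S x) is either Q x or, when S (S x) reaches 2 · Q x, the next power of two.
Q-correct : ⊢ Q-spec v0 (Q v0)
Q-correct = induction 0 (Q-spec v0 (Q v0))
  (Q-spec-μ wf-0 (∧-intro (thm pow2-1) (∧-intro (use (1T ∷ []) x∸x≐0) 1<2·1)) (use (1T ∷ []) x∸x≐0))
  (cases-on (S (S v0) <F (2T ·T Q v0))
    (Q-spec-μ (wf! (S v0)) (∧-intro (wk pow2) (∧-intro (wk Q≤SSx) #0)) (wk Q≤SSx))
    (Q-spec-μ (wf! (S v0)) (∧-intro (pow2-double (wk pow2)) (∧-intro 2Q≤SSx SSx<4Q)) 2Q≤SSx))
  where
    1<2·1 : [] ⊩ 1T <F (2T ·T 1T)
    1<2·1 = <-resp-≐ (≐-refl (wf! 1T)) (use (1T ∷ zeroT ∷ []) +-suc ▸ under (S □) (use (1T ∷ []) +-identityʳ) ▸ ≐-sym 2*1≐2)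
                     (use (1T ∷ zeroT ∷ []) x<x+Sy)
    Γ = Q-spec v0 (Q v0) ∷ []
    pow2 : Γ ⊩ IsPowerOfTwo (Q v0)
    pow2 = ∧-proj₁ #0
    Q≤SSx : Γ ⊩ Q v0 ≤F S (S v0)
    Q≤SSx = ≤-trans (∧-proj₁ (∧-proj₂ #0)) (use (S v0 ∷ []) x≤Sx)
    SSx≐2Q : ((¬' (S (S v0) <F (2T ·T Q v0))) ∷ Γ) ⊩ S (S v0) ≐ (2T ·T Q v0)
    SSx≐2Q = by-contradiction (wfF! (S (S v0) ≐ (2T ·T Q v0)))
      (absurd (∧-intro (wk (wk (mp (∧-proj₂ (∧-proj₂ #0)) (use (S v0 ∷ 2T ·T Q v0 ∷ []) x<y⇒Sx≤y)))) #0) #1)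
    2Q≤SSx : ((¬' (S (S v0) <F (2T ·T Q v0))) ∷ Γ) ⊩ (2T ·T Q v0) ≤F S (S v0)
    2Q≤SSx = ≤-respˡ-≐ SSx≐2Q (use (S (S v0) ∷ []) x∸x≐0)
    SSx<4Q : ((¬' (S (S v0) <F (2T ·T Q v0))) ∷ Γ) ⊩ S (S v0) <F (2T ·T (2T ·T Q v0))
    SSx<4Q = <-resp-≐ (≐-sym SSx≐2Q) (under ((2T ·T Q v0) +T □) SSx≐2Q ▸ ≐-sym (use (2T ·T Q v0 ∷ []) 2*x≐x+x))
                      (use (2T ·T Q v0 ∷ S v0 ∷ []) x<x+Sy)

half-pow : Tm → Tm
half-pow q = 2T ↑T P (log₂ q)

-- S (S x) < 2 q forces q > 1, hence log₂ q > 0 and q = 2 · 2^(log₂ q ∸ 1).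
Q-spec-S⇒even : ⊢ Q-spec (S v0) v1 ⇒ (v1 ≐ (half-pow v1 +T half-pow v1))
Q-spec-S⇒even = closed (⇒-intro (∨-elim (use (log₂ v1 ∷ []) x≐0∨x≐SPx)
  (absurd (under (S (S □)) x≐0 ▸ ≐-sym 2≐q) (∧-proj₂ SSx<2q))
  (≐-sym (∧-proj₁ #1) ▸ under (2T ↑T □) #0 ▸ use (2T ∷ P (log₂ v1) ∷ []) ^-suc ▸ use (half-pow v1 ∷ []) 2*x≐x+x)))
  where
    Γ = (log₂ v1 ≐ zeroT) ∷ Q-spec (S v0) v1 ∷ []
    2≐q : Γ ⊩ (2T ·T v1) ≐ 2T
    2≐q = under (2T ·T □) (≐-sym (∧-proj₁ #1) ▸ under (2T ↑T □) #0 ▸ use (2T ∷ []) ^-0) ▸ 2*1≐2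
    SSx<2q : Γ ⊩ S (S v0) <F (2T ·T v1)
    SSx<2q = ∧-proj₂ (∧-proj₂ #1)
    x≐0 : Γ ⊩ v0 ≐ zeroT
    x≐0 = mp (≐-sym (use (S v0 ∷ S zeroT ∷ []) Sx∸Sy≐x∸y ▸ use (v0 ∷ zeroT ∷ []) Sx∸Sy≐x∸y) ▸ ≤-respʳ-≐ 2≐q (∧-proj₁ SSx<2q))
             (use (v0 ∷ []) x≤0⇒x≐0)

Q-spec-S⇒≤3⇒≐2 : ⊢ Q-spec (S v0) v1 ⇒ ((v1 ≤F S 2T) ⇒ (v1 ≐ 2T))
Q-spec-S⇒≤3⇒≐2 = closed (⇒-intro (⇒-intro (∨-elim (mp h≤1 (use (half-pow v1 ∷ zeroT ∷ []) x≤Sy⇒x≤y∨x≐Sy))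
  (absurd (mp (≤-respʳ-≐ (under (2T ·T □) q≐0 ▸ use (2T ∷ []) *-zeroʳ) (∧-proj₁ (∧-proj₂ (∧-proj₂ #2)))) (use (S (S v0) ∷ []) x≤0⇒x≐0))
          (S≢0 (wf! (S v0))))
  (wk q≐h+h ▸ under (□ +T □) #0 ▸ 1+1≐2))))
  where
    Γ = (v1 ≤F S 2T) ∷ Q-spec (S v0) v1 ∷ []
    q≐h+h : Γ ⊩ v1 ≐ (half-pow v1 +T half-pow v1)
    q≐h+h = mp #1 (use (v0 ∷ v1 ∷ []) Q-spec-S⇒even)
    h≤1 : Γ ⊩ half-pow v1 ≤F 1T
    h≤1 = mp (≤-respˡ-≐ q≐h+h (≤-respʳ-≐ (under (S □) (≐-sym 1+1≐2)) #0)) (use (half-pow v1 ∷ 1T ∷ []) x+x≤S[y+y]⇒x≤y)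
    q≐0 : ((half-pow v1 ≤F zeroT) ∷ Γ) ⊩ v1 ≐ zeroT
    q≐0 = wk q≐h+h ▸ under (□ +T □) (mp #0 (use (half-pow v1 ∷ []) x≤0⇒x≐0)) ▸ use (zeroT ∷ []) +-identityʳ

Q1≐2 : ⊢ Q 1T ≐ 2T
Q1≐2 = closed (mp (≤-trans (∧-proj₁ (∧-proj₂ spec)) (use (2T ∷ []) x≤Sx)) (mp spec (use (zeroT ∷ Q 1T ∷ []) Q-spec-S⇒≤3⇒≐2)))
  where
    spec : [] ⊩ Q-spec 1T (Q 1T)
    spec = use (1T ∷ []) Q-correct

Q2≐2 : ⊢ Q 2T ≐ 2T
Q2≐2 = closed (mp (∧-proj₁ (∧-proj₂ spec)) (mp spec (use (1T ∷ Q 2T ∷ []) Q-spec-S⇒≤3⇒≐2)))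
  where
    spec : [] ⊩ Q-spec 2T (Q 2T)
    spec = use (2T ∷ []) Q-correct

x*2≐x+x : ⊢ (v0 ·T 2T) ≐ (v0 +T v0)
x*2≐x+x = closed (use (v0 ∷ 1T ∷ []) *-suc ▸ under (v0 +T □)
  (use (v0 ∷ zeroT ∷ []) *-suc ▸ under (v0 +T □) (use (v0 ∷ []) *-zeroʳ) ▸ use (v0 ∷ []) +-identityʳ))

x⊕0̄≐S[x+x] : ⊢ (v0 ⊕ 0̄) ≐ S (v0 +T v0)
x⊕0̄≐S[x+x] = closed (under (P ((S v0 ·T □) +T R 1T)) (thm Q1≐2) ▸ under (P ((S v0 ·T 2T) +T □)) R1≐0
  ▸ under (P □) (use (S v0 ·T 2T ∷ []) +-identityʳ ▸ use (S v0 ∷ []) x*2≐x+x ▸ use (v0 ∷ []) Sx+Sx≐SS[x+x]) ▸ use (zeroT ∷ S (v0 +T v0) ∷ []) P-S)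
  where
    R1≐0 : [] ⊩ R 1T ≐ zeroT
    R1≐0 = under (S 1T -T □) (thm Q1≐2) ▸ use (2T ∷ []) x∸x≐0

x⊕1̄≐SS[x+x] : ⊢ (v0 ⊕ 1̄) ≐ S (S (v0 +T v0))
x⊕1̄≐SS[x+x] = closed (under (P ((S v0 ·T □) +T R 2T)) (thm Q2≐2) ▸ under (P ((S v0 ·T 2T) +T □)) R2≐1
  ▸ under (P □) (use (S v0 ·T 2T ∷ zeroT ∷ []) +-suc) ▸ use (zeroT ∷ (S v0 ·T 2T) +T zeroT ∷ []) P-S
  ▸ use (S v0 ·T 2T ∷ []) +-identityʳ ▸ use (S v0 ∷ []) x*2≐x+x ▸ use (v0 ∷ []) Sx+Sx≐SS[x+x])
  where
    R2≐1 : [] ⊩ R 2T ≐ 1T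
    R2≐1 = under (S 2T -T □) (thm Q2≐2) ▸ use (2T ∷ []) Sx∸x≐1

-- Chop

Chop-halves : ⊢ (Half (Q v0) ≐ v1) ⇒ ((Half (R v0) ≐ (S v2 -T v1)) ⇒ ((v1 ≤F S v2) ⇒ (Chop v0 ≐ v2)))
Chop-halves = closed (⇒-intro (⇒-intro (⇒-intro
  (under (P (□ +T Half (R v0))) #2 ▸ under (P (v1 +T □)) #1 ▸ under (P □) (mp #0 (use (v1 ∷ S v2 ∷ []) x≤y⇒x+[y∸x]≐y))
   ▸ use (zeroT ∷ v2 ∷ []) P-S))))

QS≐h+h : ⊢ Q (S v0) ≐ (half-pow (Q (S v0)) +T half-pow (Q (S v0)))
QS≐h+h = closed (mp (use (S v0 ∷ []) Q-correct) (use (v0 ∷ Q (S v0) ∷ []) Q-spec-S⇒even))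

Half-QS : ⊢ Half (Q (S v0)) ≐ half-pow (Q (S v0))
Half-QS = closed (under (Half □) (thm QS≐h+h) ▸ use (half-pow (Q (S v0)) ∷ []) Half-double)

Chop-S[x+x]≐x : ⊢ Chop (S (v0 +T v0)) ≐ v0
Chop-S[x+x]≐x = closed (mp h≤Sx (mp Half-R (mp (use (v0 +T v0 ∷ []) Half-QS) (use (t ∷ h ∷ v0 ∷ []) Chop-halves))))
  where
    t = S (v0 +T v0)
    h = half-pow (Q t)
    Q≐h+h : [] ⊩ Q t ≐ (h +T h)
    Q≐h+h = use (v0 +T v0 ∷ []) QS≐h+h
    h≤Sx : [] ⊩ h ≤F S v0
    h≤Sx = mp (≤-trans (≤-respʳ-≐ (≐-sym (use (v0 ∷ []) Sx+Sx≐SS[x+x])) (≤-respˡ-≐ Q≐h+h (∧-proj₁ (∧-proj₂ (use (t ∷ []) Q-correct)))))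
                       (use (S v0 +T S v0 ∷ []) x≤Sx))
              (use (h ∷ S v0 ∷ []) x+x≤S[y+y]⇒x≤y)
    Half-R : [] ⊩ Half (R t) ≐ (S v0 -T h)
    Half-R = under (Half □) (under (S t -T □) Q≐h+h ▸ under (□ -T (h +T h)) (≐-sym (use (v0 ∷ []) Sx+Sx≐SS[x+x]))
                              ▸ mp h≤Sx (use (h ∷ S v0 ∷ []) x≤y⇒[y+y]∸[x+x]≐[y∸x]+[y∸x]))
             ▸ use (S v0 -T h ∷ []) Half-double

Chop-SS[x+x]≐x : ⊢ Chop (S (S (v0 +T v0))) ≐ v0
Chop-SS[x+x]≐x = closed (mp h≤Sx (mp Half-R (mp (use (S (v0 +T v0) ∷ []) Half-QS) (use (t ∷ h ∷ v0 ∷ []) Chop-halves))))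
  where
    t = S (S (v0 +T v0))
    h = half-pow (Q t)
    Q≐h+h : [] ⊩ Q t ≐ (h +T h)
    Q≐h+h = use (S (v0 +T v0) ∷ []) QS≐h+h
    h≤Sx : [] ⊩ h ≤F S v0
    h≤Sx = mp (≤-respʳ-≐ (under (S □) (≐-sym (use (v0 ∷ []) Sx+Sx≐SS[x+x]))) (≤-respˡ-≐ Q≐h+h (∧-proj₁ (∧-proj₂ (use (t ∷ []) Q-correct)))))
              (use (h ∷ S v0 ∷ []) x+x≤S[y+y]⇒x≤y)
    Half-R : [] ⊩ Half (R t) ≐ (S v0 -T h)
    Half-R = under (Half □) (under (S t -T □) Q≐h+h ▸ under (□ -T (h +T h)) (under (S □) (≐-sym (use (v0 ∷ []) Sx+Sx≐SS[x+x])))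
                              ▸ mp (mp h≤Sx (use (h ∷ S v0 ∷ []) x≤y⇒x+x≤y+y)) (use (S v0 +T S v0 ∷ h +T h ∷ []) y≤x⇒Sx∸y≐S[x∸y])
                              ▸ under (S □) (mp h≤Sx (use (h ∷ S v0 ∷ []) x≤y⇒[y+y]∸[x+x]≐[y∸x]+[y∸x])))
             ▸ use (S v0 -T h ∷ []) Half-suc-double

Sx≢x : ⊢ ¬' (S v0 ≐ v0)
Sx≢x = closed (¬-intro (wfF! (S v0 ≐ v0))
  (absurd (≐-sym (use (v0 ∷ []) Sx∸x≐1) ▸ under (S v0 -T □) (≐-sym #0) ▸ use (S v0 ∷ []) x∸x≐0) (S≢0 wf-0)))

-- Recursion on binary strings

-- fBody y z b c is Body (var y) on the nose; writing the tests in var 0 lets them be instantiated at any u.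
Test₀ Test₁ ChopS : Tm
Test₀ = χ (S v0 ≐ (Chop (S v0) ⊕ 0̄))
Test₁ = χ (S v0 ≐ (Chop (S v0) ⊕ 1̄))
ChopS = Chop (S v0)

module ChopRecursion {n} (xs : Vec Var n) (y z : Var) (a b c : Tm)
                     (distinct : Unique (y ∷ z ∷ toList xs))
                     (a⊆ : vars a ⊆ toList xs) (b⊆ : vars b ⊆ (z ∷ toList xs)) (c⊆ : vars c ⊆ (z ∷ toList xs))
                     (wa : WFTm a) (wb : WFTm b) (wc : WFTm c) where

  Body : Tm → Tm
  Body u = C (at u Test₀) (substT z (at u ChopS) b) (C (at u Test₁) (substT z (at u ChopS) c) zeroT)

  f : Tm → Tm
  f = appRec (fSym xs y z a b c) xs

  private
    xs∌y : ∀ {v} → v ∈ toList xs → v ≢ y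
    xs∌y v∈xs v≡y = Unique-∉₀ distinct v∈xs (sym v≡y)

    xs∌z : ∀ {v} → v ∈ toList xs → v ≢ z
    xs∌z v∈xs v≡z = Unique-∉₁ distinct v∈xs (sym v≡z)

    only0-Test₀ : Only0 Test₀
    only0-Test₀ = only0! Test₀
    only0-Test₁ : Only0 Test₁
    only0-Test₁ = only0! Test₁
    only0-ChopS : Only0 ChopS
    only0-ChopS = only0! ChopS

    vars-branch : ∀ {d v} → vars d ⊆ (z ∷ toList xs) → v ∈ vars (substT z (at (var y) ChopS) d) → v ∈ (y ∷ z ∷ toList xs)
    vars-branch {d} d⊆ v∈ with vars-substT z (at (var y) ChopS) d v∈
    ... | inj₁ v∈Chop = here (singleton⁻ (vars-at {var y} {ChopS} only0-ChopS v∈Chop))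
    ... | inj₂ (v∈d , v≢z) with All.lookup d⊆ v∈d
    ...   | here v≡z = ⊥-elim (v≢z v≡z)
    ...   | there v∈xs = there (there v∈xs)

    vars-Body : ∀ {v} → v ∈ vars (Body (var y)) → v ∈ (y ∷ z ∷ toList xs)
    vars-Body v∈ with vars-C {at (var y) Test₀} {substT z (at (var y) ChopS) b} {C (at (var y) Test₁) (substT z (at (var y) ChopS) c) zeroT} v∈
    ... | inj₁ v∈T = here (singleton⁻ (vars-at {var y} {Test₀} only0-Test₀ v∈T))
    ... | inj₂ (inj₁ v∈b) = vars-branch {b} b⊆ v∈b
    ... | inj₂ (inj₂ v∈C) with vars-C {at (var y) Test₁} {substT z (at (var y) ChopS) c} {zeroT} v∈C
    ...   | inj₁ v∈T = here (singleton⁻ (vars-at {var y} {Test₁} only0-Test₁ v∈T))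
    ...   | inj₂ (inj₁ v∈c) = vars-branch {c} c⊆ v∈c

    wf-at : ∀ {u} t {ok : T (wf? t)} → WFTm u → WFTm (at u t)
    wf-at t {ok} wu = wf-sub (wf-⟪⟫ (wu ∷ [])) (wf?-sound t ok)

    wf-branch : ∀ {u d} → WFTm u → WFTm d → WFTm (substT z (at u ChopS) d)
    wf-branch wu wd = wf-substT (wf-at ChopS wu) wd

    wf-else : ∀ {u} → WFTm u → WFTm (C (at u Test₁) (substT z (at u ChopS) c) zeroT)
    wf-else wu = wf-C (wf-at Test₁ wu) (wf-branch wu wc) wf-0

    wf-Body : ∀ {u} → WFTm u → WFTm (Body u)
    wf-Body wu = wf-C (wf-at Test₀ wu) (wf-branch wu wb) (wf-else wu)

  wf-fSym : WFFn (fSym xs y z a b c)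
  wf-fSym = wf-rec distinct a⊆ (All.tabulate vars-Body) wa (wf-Body (wf-var y))

  f-suc : ∀ {u} → WFTm u → ⊢ f (S u) ≐ Body u
  f-suc {u} wu = ⊢-≡ (cong (f (S u) ≐_) body-at-u) (⊢-rec-suc wf-fSym wu)
    where
      σ : Subst
      σ = update (y ↦ u) z (f u)
      σy : σ y ≡ u
      σy = trans (update-other (y ↦ u) (f u) (Unique-≢ distinct)) (update-same var y u)
      σ-fixes : ∀ {v} → v ∈ (z ∷ toList xs) → v ≢ z → σ v ≡ var v
      σ-fixes (here v≡z) v≢z = ⊥-elim (v≢z v≡z)
      σ-fixes (there v∈xs) _ = trans (update-other (y ↦ u) (f u) (xs∌z v∈xs)) (update-other var u (xs∌y v∈xs))
      branch : ∀ d → vars d ⊆ (z ∷ toList xs) → sub σ (substT z (at (var y) ChopS) d) ≡ substT z (at u ChopS) d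
      branch d d⊆ = trans (sub-substT σ z _ d λ v∈d → σ-fixes (All.lookup d⊆ v∈d))
                          (cong (λ s → substT z s d) (trans (sub-at σ y ChopS only0-ChopS) (cong (λ s → at s ChopS) σy)))
      test : ∀ t → Only0 t → sub σ (at (var y) t) ≡ at u t
      test t only0 = trans (sub-at σ y t only0) (cong (λ s → at s t) σy)
      body-at-u : sub σ (Body (var y)) ≡ Body u
      body-at-u = cong₃ C (test Test₀ only0-Test₀) (branch b b⊆) (cong₃ C (test Test₁ only0-Test₁) (branch c c⊆) refl)

  f-ε : ⊢ f ε ≐ a
  f-ε = ax-def0 wf-fSym

  f-⊕0̄ : ∀ w → ⊢ f (var w ⊕ 0̄) ≐ substT z (var w) b
  f-⊕0̄ w = closed (appRec-cong wf-fSym ⊕0̄ ▸ thm (f-suc wu) ▸ C-χ-true (wf-branch wu wb) (wf-else wu) test₀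
                   ▸ ≐-cong b z wb chop)
    where
      u : Tm
      u = var w +T var w
      wu : WFTm u
      wu = wf-+ (wf-var w) (wf-var w)
      ⊕0̄ : [] ⊩ (var w ⊕ 0̄) ≐ S u
      ⊕0̄ = use′ (var w ∷ []) (wf-var w ∷ []) x⊕0̄≐S[x+x]
      chop : [] ⊩ Chop (S u) ≐ var w
      chop = use′ (var w ∷ []) (wf-var w ∷ []) Chop-S[x+x]≐x
      test₀ : [] ⊩ S u ≐ (Chop (S u) ⊕ 0̄)
      test₀ = ≐-sym ⊕0̄ ▸ ≐-sym (under (□ ⊕ 0̄) chop)

  f-⊕1̄ : ∀ w → ⊢ f (var w ⊕ 1̄) ≐ substT z (var w) c
  f-⊕1̄ w = closed (appRec-cong wf-fSym ⊕1̄ ▸ thm (f-suc wu) ▸ C-χ-false (wf-branch wu wb) (wf-else wu) ¬test₀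
                   ▸ C-χ-true (wf-branch wu wc) wf-0 test₁ ▸ ≐-cong c z wc chop)
    where
      u : Tm
      u = S (var w +T var w)
      wu : WFTm u
      wu = wf-S (wf-+ (wf-var w) (wf-var w))
      ⊕1̄ : [] ⊩ (var w ⊕ 1̄) ≐ S u
      ⊕1̄ = use′ (var w ∷ []) (wf-var w ∷ []) x⊕1̄≐SS[x+x]
      chop : ∀ {Γ} → Γ ⊩ Chop (S u) ≐ var w
      chop = use′ (var w ∷ []) (wf-var w ∷ []) Chop-SS[x+x]≐x
      test₁ : [] ⊩ S u ≐ (Chop (S u) ⊕ 1̄)
      test₁ = ≐-sym ⊕1̄ ▸ ≐-sym (under (□ ⊕ 1̄) chop)
      test₀-wf : WFFm (S u ≐ (Chop (S u) ⊕ 0̄))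
      test₀-wf = wf-eq (wf-S wu) (wf-at (Chop (S v0) ⊕ 0̄) wu)
      ¬test₀ : [] ⊩ ¬' (S u ≐ (Chop (S u) ⊕ 0̄))
      ¬test₀ = ¬-intro test₀-wf (ex-falso (wf-neg test₀-wf)
        (assumption test₀-wf ▸ under (□ ⊕ 0̄) chop ▸ use′ (var w ∷ []) (wf-var w ∷ []) x⊕0̄≐S[x+x])
        (use′ (u ∷ []) (wu ∷ []) Sx≢x))

proposition8 : ∀ {n} (xs : Vec Var n) (y z : Var) (a b c : Tm) (w : Var) →
    Unique (y ∷ z ∷ toList xs) →
    vars a ⊆ toList xs → vars b ⊆ (z ∷ toList xs) → vars c ⊆ (z ∷ toList xs) →
    WFTm a → WFTm b → WFTm c →
    ⊢ (appRec (fSym xs y z a b c) xs ε ≐ a)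
      ∧' ((appRec (fSym xs y z a b c) xs (var w ⊕ 0̄) ≐ substT z (var w) b)
      ∧' (appRec (fSym xs y z a b c) xs (var w ⊕ 1̄) ≐ substT z (var w) c))
proposition8 xs y z a b c w distinct a⊆ b⊆ c⊆ wa wb wc = closed (∧-intro (thm f-ε) (∧-intro (thm (f-⊕0̄ w)) (thm (f-⊕1̄ w))))
  where open ChopRecursion xs y z a b c distinct a⊆ b⊆ c⊆ wa wb wc
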